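{- There is a procedure that, given a string $T[1..n]$ over a general unordered alphabet containing $\sigma$ distinct symbols and positions $i_1,\dots,i_b$, constructs the sparse suffix tree of the suffixes $T[i_1..n],\dots,T[i_b..n]$, such that for any sequence of $k$ invocations of the procedure on the same string $T$ with $b_1,\dots,b_k$ suffixes respectively, the total number of comparisons is $\mathcal{O}\big(n+\sum_{j=1}^{k} b_j\sigma\log b_j\big)$ (that is, each invocation uses $\mathcal{O}(b\sigma\log b)$ comparisons, plus $\mathcal{O}(n)$ comparisons shared by all invocations).
   Context: Comparisons are queries "is $T[x]=T[y]$?". $T$ is assumed to end with a special symbol $T[n]$ occurring nowhere else. The sparse suffix tree of a set of suffixes is the compacted trie of those suffixes: the rooted tree obtained from the trie of the strings (edges labelled by single symbols, children of a node having distinct edge labels) by contracting all non-branching internal nodes into single edges labelled by the concatenated strings; leaves are labelled by the starting positions of the suffixes. -}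

module Defs where

open import Data.Bool using (Bool)
open import Data.Nat using (ℕ; zero; suc; _+_; _*_; _≤_)
open import Data.Nat.Logarithm using (⌈log₂_⌉)
open import Data.Fin using (Fin; toℕ; fromℕ)
open import Data.List using (List; []; _∷_; _++_; map; length; tabulate; take; drop; deduplicate; [_])
open import Data.Nat.ListAction using (sum)
open import Data.List.Relation.Unary.AllPairs using (AllPairs)
open import Data.List.Relation.Unary.All using (All)
open import Data.List.Relation.Unary.Unique.Propositional using (Unique)
open import Data.List.Relation.Binary.Pointwise using (Pointwise)
open import Data.List.Relation.Binary.Permutation.Propositional using (_↭_)
open import Data.Product using (Σ; _×_; _,_; proj₁; proj₂; map₁)
open import Relation.Binary.Definitions using (DecidableEquality)
open import Relation.Binary.PropositionalEquality using (_≡_; _≢_)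
open import Relation.Nullary using (does)
open import Data.Empty using (⊥)

-- Strings: a string of length n over A is T : Fin n → A (0-based positions).

toList : {A : Set} {n : ℕ} → (Fin n → A) → List A
toList {n = n} T = tabulate T

suffix : {A : Set} {n : ℕ} → (Fin n → A) → Fin n → List A
suffix T i = drop (toℕ i) (toList T)

substr : {A : Set} {n : ℕ} → (Fin n → A) → Fin n → ℕ → List A
substr T p l = take l (suffix T p)

Sentinel : {A : Set} {m : ℕ} → (Fin (suc m) → A) → Set
Sentinel {m = m} T = ∀ j → T j ≡ T (fromℕ m) → j ≡ fromℕ m

σ : {A : Set} {n : ℕ} → DecidableEquality A → (Fin n → A) → ℕ
σ _≟_ T = length (deduplicate _≟_ (toList T))

-- Comparison model: the only access to T is queries "is T[x] = T[y]?".

data Comp (n : ℕ) (X : Set) : Set where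
  ret : X → Comp n X
  ask : Fin n → Fin n → (Bool → Comp n X) → Comp n X

run : {A : Set} {n : ℕ} {X : Set} → DecidableEquality A → (Fin n → A) → Comp n X → X × ℕ
run eq T (ret x) = x , 0
run eq T (ask x y k) with run eq T (k (does (eq (T x) (T y))))
... | r , c = r , suc c

-- Trees with edges labelled by substrings of T (given as start position,
-- length) and leaves labelled by positions. Children are an (unordered,
-- i.e. arbitrary-order) list.

data STree (n : ℕ) : Set where
  leaf : Fin n → STree n
  node : List (Fin n × ℕ × STree n) → STree n

module _ {A : Set} {n : ℕ} (T : Fin n → A) where

  mutual
    leaves : STree n → List (List A × Fin n)
    leaves (leaf i) = [ ([] , i) ]
    leaves (node cs) = leavesL cs

    leavesL : List (Fin n × ℕ × STree n) → List (List A × Fin n)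
    leavesL [] = []
    leavesL ((p , l , t) ∷ cs) = map (map₁ (substr T p l ++_)) (leaves t) ++ leavesL cs

  EdgeOK : Fin n → ℕ → Set
  EdgeOK p l = (1 ≤ l) × (toℕ p + l ≤ n)

  DistinctFirst : List (Fin n × ℕ × STree n) → Set
  DistinctFirst cs = AllPairs (λ e e' → T (proj₁ e) ≢ T (proj₁ e')) cs

  mutual
    data NonRootOK : STree n → Set where
      leafOK : ∀ i → NonRootOK (leaf i)
      nodeOK : ∀ {cs} → 2 ≤ length cs → DistinctFirst cs → ChildrenOK cs → NonRootOK (node cs)

    data ChildrenOK : List (Fin n × ℕ × STree n) → Set where
      []  : ChildrenOK []
      _∷_ : ∀ {p l t cs} → EdgeOK p l × NonRootOK t → ChildrenOK cs → ChildrenOK ((p , l , t) ∷ cs)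

  -- the tree is the sparse suffix tree (compacted trie) of the suffixes at positions Is:
  -- root node (may be non-branching), every other internal node branching, edges
  -- nonempty with distinct first symbols among siblings, and the leaves (with their
  -- root-to-leaf strings) are exactly the suffixes T[i..n], i ∈ Is, each once.
  IsSST : List (Fin n) → STree n → Set
  IsSST Is (leaf _) = ⊥
  IsSST Is (node cs) =
    DistinctFirst cs × ChildrenOK cs × (leavesL cs ↭ map (λ i → suffix T i , i) Is)

-- A procedure with persistent state (per string length) across invocations.

record Procedure : Set₁ where
  field
    State : ℕ → Set
    init  : (n : ℕ) → State n
    step  : {n : ℕ} → State n → List (Fin n) → Comp n (State n × STree n)

runSeq : (P : Procedure) {A : Set} {n : ℕ} → DecidableEquality A → (Fin n → A) →
         Procedure.State P n → List (List (Fin n)) → List (STree n) × ℕ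
runSeq P eq T s [] = [] , 0
runSeq P eq T s (I ∷ Is) with run eq T (Procedure.step P s I)
... | (s' , t) , c with runSeq P eq T s' Is
...   | ts , c' = t ∷ ts , c + c'

costSum : {n : ℕ} → ℕ → List (List (Fin n)) → ℕ
costSum sig Is = sum (map (λ I → length I * sig * ⌈log₂ length I ⌉) Is)

-- Each invocation builds its sparse suffix tree bottom-up: the b requested suffixes start as
-- one-leaf tries, which ⌈log₂ b⌉ rounds merge pairwise.  Two compacted tries are merged by
-- pairing the children of a node by first symbol, each child being compared with at most σ
-- siblings, and by comparing a paired edge symbol by symbol up to the first mismatch.
-- Counting only mismatching comparisons, a merge costs O(σ) per edge, and a trie with b leaves
-- whose internal nodes branch has fewer than 2b edges; so an invocation costs O(bσ log b).
-- Matching comparisons are paid for by memoising comparisons in a union–find structure kept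
-- across invocations: a query is asked only for positions in different classes, and a positive
-- answer merges two classes, which happens fewer than n times in total.
-- The unique last symbol makes the suffixes prefix-free, so every suffix ends in its own leaf.

{-# OPTIONS --safe #-}
module Submission where

open import Defs
open import Data.Bool using (Bool; true; false; if_then_else_)
open import Data.Empty using (⊥-elim)
open import Data.Fin using (Fin; toℕ; fromℕ<; fromℕ; zero; suc) renaming (_≟_ to _≟ᶠ_)
open import Data.Fin.Properties using (toℕ-injective; toℕ-fromℕ<; toℕ-fromℕ; toℕ<n) renaming (suc-injective to Fin-suc-injective)
open import Data.List using (List; []; _∷_; [_]; length; map; take; drop; tabulate; _++_; concatMap)
open import Data.List.Properties
open import Data.List.Membership.Propositional using (_∈_)
open import Data.List.Membership.Propositional.Properties using (∈-map⁺; ∈-map⁻; ∈-++⁺ˡ; ∈-++⁺ʳ; ∈-++⁻; ∈-∃++; ∈-tabulate⁺; ∈-deduplicate⁺)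
open import Data.List.Relation.Binary.Disjoint.Propositional using (Disjoint)
import Data.List.Relation.Binary.Disjoint.Propositional.Properties as Disjoint
open import Data.List.Relation.Binary.Permutation.Propositional using (_↭_; ↭-refl; ↭-sym; ↭-trans; ↭-reflexive; ↭⇒↭ₛ; module PermutationReasoning)
open import Data.List.Relation.Binary.Permutation.Propositional.Properties using (All-resp-↭; shifts; ++⁺ˡ; ++⁺ʳ; ↭-length) renaming (++-comm to ↭-++-comm; map⁺ to ↭-map⁺)
import Data.List.Relation.Binary.Permutation.Setoid.Properties as PermutationSetoid
open import Data.List.Relation.Binary.Pointwise using (Pointwise; []; _∷_)
open import Data.List.Relation.Binary.Sublist.Propositional using ([]; _∷_; _∷ʳ_) renaming (_⊆_ to _⊑_; ⊆-refl to ⊑-refl)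
open import Data.List.Relation.Binary.Sublist.Propositional.Properties using (All-resp-⊆; length-mono-≤)
open import Data.List.Relation.Binary.Subset.Propositional using (_⊆_)
open import Data.List.Relation.Binary.Subset.Propositional.Properties using (xs⊆xs++ys; xs⊆ys++xs)
import Data.List.Relation.Binary.Subset.Propositional.Properties as Subset
open import Data.List.Relation.Unary.All as All using (All; []; _∷_)
import Data.List.Relation.Unary.All.Properties as All
open import Data.List.Relation.Unary.AllPairs using ([]; _∷_)
import Data.List.Relation.Unary.AllPairs.Properties as AllPairs
open import Data.List.Relation.Unary.Any using (here; there)
open import Data.List.Relation.Unary.Unique.Propositional using (Unique)
import Data.List.Relation.Unary.Unique.Propositional.Properties as Unique
open import Data.Nat using (ℕ; zero; suc; _+_; _*_; _≤_; _<_; _∸_; z≤n; s≤s; z<s; _<?_; _≤?_; ⌈_/2⌉)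
open import Data.Nat.ListAction using (sum)
open import Data.Nat.Logarithm using (⌈log₂_⌉; ⌈log₂⌈n/2⌉⌉≡⌈log₂n⌉∸1; ⌈log₂⌉-mono-≤)
open import Data.Nat.Properties
open import Data.Nat.Tactic.RingSolver using (solve-∀)
open import Data.Product using (Σ; _×_; _,_; proj₁; proj₂; ∃; map₁)
open import Data.Sum using (inj₁; inj₂)
open import Function using (_∘_; id; flip; case_of_)
open import Relation.Binary.Definitions using (DecidableEquality)
open import Relation.Binary.PropositionalEquality hiding ([_])
open import Relation.Nullary using (yes; no; does; ¬_)
open import Relation.Nullary.Decidable using (dec-true; dec-false)

take-++-drop : ∀ {X : Set} h l (xs : List X) → h ≤ l → take l xs ≡ take h xs ++ take (l ∸ h) (drop h xs)
take-++-drop zero l xs z≤n = refl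
take-++-drop (suc h) (suc l) [] (s≤s _) = sym (take-[] (l ∸ h))
take-++-drop (suc h) (suc l) (x ∷ xs) (s≤s h≤l) = cong (x ∷_) (take-++-drop h l xs h≤l)

drop-length-++ : ∀ {X : Set} (u v : List X) → drop (length u) (u ++ v) ≡ v
drop-length-++ [] v = refl
drop-length-++ (x ∷ u) v = drop-length-++ u v

drop-tabulate : ∀ {X : Set} {k} (g : Fin k → X) (i : Fin k) →
                drop (toℕ i) (tabulate g) ≡ g i ∷ drop (suc (toℕ i)) (tabulate g)
drop-tabulate g zero = refl
drop-tabulate g (suc i) = drop-tabulate (λ z → g (suc z)) i

module _ {X : Set} where

  unique-⊆⇒length≤ : ∀ {xs ys : List X} → Unique xs → (∀ {x} → x ∈ xs → x ∈ ys) → length xs ≤ length ys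
  unique-⊆⇒length≤ {[]} _ _ = z≤n
  unique-⊆⇒length≤ {x ∷ xs} {ys} (x∉xs ∷ unique) xs⊆ys with ∈-∃++ (xs⊆ys (here refl))
  ... | us , vs , refl = begin
    suc (length xs)          ≤⟨ s≤s (unique-⊆⇒length≤ unique xs⊆us++vs) ⟩
    suc (length (us ++ vs))  ≡⟨ cong suc (length-++ us) ⟩
    suc (length us + length vs) ≡⟨ +-suc (length us) (length vs) ⟨
    length us + length (x ∷ vs) ≡⟨ length-++ us ⟨
    length (us ++ x ∷ vs)    ∎
    where
    open ≤-Reasoning
    xs⊆us++vs : ∀ {z} → z ∈ xs → z ∈ us ++ vs
    xs⊆us++vs {z} z∈xs with ∈-++⁻ us (xs⊆ys (there z∈xs))
    ... | inj₁ z∈us = ∈-++⁺ˡ z∈us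
    ... | inj₂ (here z≡x) = ⊥-elim (All.lookup x∉xs z∈xs (sym z≡x))
    ... | inj₂ (there z∈vs) = ∈-++⁺ʳ us z∈vs

  Unique-resp-↭ : ∀ {xs ys : List X} → xs ↭ ys → Unique xs → Unique ys
  Unique-resp-↭ xs↭ys = PermutationSetoid.Unique-resp-↭ (setoid X) (↭⇒↭ₛ xs↭ys)

  Unique-++⁻ʳ : ∀ xs {ys : List X} → Unique (xs ++ ys) → Unique ys
  Unique-++⁻ʳ xs {ys} unique = subst Unique (drop-length-++ xs ys) (Unique.drop⁺ (length xs) unique)

  Unique-++⇒Disjoint : ∀ xs {ys : List X} → Unique (xs ++ ys) → Disjoint xs ys
  Unique-++⇒Disjoint (x ∷ xs) (x∉ ∷ _) (here refl , x∈ys) = All.lookup (All.++⁻ʳ xs x∉) x∈ys refl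
  Unique-++⇒Disjoint (x ∷ xs) (_ ∷ unique) (there v∈xs , v∈ys) = Unique-++⇒Disjoint xs unique (v∈xs , v∈ys)

disjoint-⊆ : ∀ {X : Set} {xs xs' ys ys' : List X} → xs' ⊆ xs → ys' ⊆ ys → Disjoint xs ys → Disjoint xs' ys'
disjoint-⊆ xs'⊆xs ys'⊆ys disjoint (v∈xs' , v∈ys') = disjoint (xs'⊆xs v∈xs' , ys'⊆ys v∈ys')

infixl 1 _>>=_
_>>=_ : ∀ {n X Y} → Comp n X → (X → Comp n Y) → Comp n Y
ret x >>= f = f x
ask x y k >>= f = ask x y (λ b → k b >>= f)

module Evaluation {A : Set} (_≟_ : DecidableEquality A) {n : ℕ} (T : Fin n → A) where

  value : ∀ {X} → Comp n X → X
  value (ret x) = x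
  value (ask x y k) = value (k (does (T x ≟ T y)))

  mismatches : ∀ {X} → Comp n X → ℕ
  mismatches (ret x) = 0
  mismatches (ask x y k) = (if does (T x ≟ T y) then 0 else 1) + mismatches (k (does (T x ≟ T y)))

  value->>= : ∀ {X Y} (c : Comp n X) (f : X → Comp n Y) → value (c >>= f) ≡ value (f (value c))
  value->>= (ret x) f = refl
  value->>= (ask x y k) f = value->>= (k _) f

  queries : ∀ {X} → Comp n X → ℕ
  queries (ret x) = 0
  queries (ask x y k) = suc (queries (k (does (T x ≟ T y))))

  run≡value,queries : ∀ {X} (c : Comp n X) → run _≟_ T c ≡ (value c , queries c)
  run≡value,queries (ret x) = refl
  run≡value,queries (ask x y k) rewrite run≡value,queries (k (does (T x ≟ T y))) = refl

  mismatches->>= : ∀ {X Y} (c : Comp n X) (f : X → Comp n Y) →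
                   mismatches (c >>= f) ≡ mismatches c + mismatches (f (value c))
  mismatches->>= (ret x) f = refl
  mismatches->>= (ask x y k) f with T x ≟ T y
  ... | yes _ = mismatches->>= (k true) f
  ... | no _ = cong suc (mismatches->>= (k false) f)

-- A union–find structure, flattened: r z is the representative of the class of z.
Representatives : ℕ → Set
Representatives n = Fin n → Fin n

identify : ∀ {n} → Representatives n → Fin n → Fin n → Representatives n
identify r a b z with r z ≟ᶠ b
... | yes _ = a
... | no _ = r z

memoise : ∀ {n X} → Representatives n → Comp n X → Comp n (Representatives n × X)
memoise r (ret x) = ret (r , x)
memoise r (ask x y k) with r x ≟ᶠ r y
... | yes _ = memoise r (k true)
... | no _ = ask x y λ where
  true → memoise (identify r (r x) (r y)) (k true)
  false → memoise r (k false)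

countTrue : ∀ {n} → (Fin n → Bool) → ℕ
countTrue {zero} g = 0
countTrue {suc n} g = (if g zero then 1 else 0) + countTrue (λ z → g (suc z))

countTrue≤n : ∀ {n} (g : Fin n → Bool) → countTrue g ≤ n
countTrue≤n {zero} g = z≤n
countTrue≤n {suc n} g with g zero
... | true = s≤s (countTrue≤n (λ z → g (suc z)))
... | false = m≤n⇒m≤1+n (countTrue≤n (λ z → g (suc z)))

countTrue-cong : ∀ {n} {g g' : Fin n → Bool} → (∀ z → g z ≡ g' z) → countTrue g ≡ countTrue g'
countTrue-cong {zero} eq = refl
countTrue-cong {suc n} eq = cong₂ _+_ (cong (λ c → if c then 1 else 0) (eq zero)) (countTrue-cong (λ z → eq (suc z)))

countTrue-flip : ∀ {n} (b : Fin n) {g g' : Fin n → Bool} → g b ≡ true → g' b ≡ false →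
                 (∀ z → z ≢ b → g z ≡ g' z) → countTrue g ≡ suc (countTrue g')
countTrue-flip zero gb g'b rest rewrite gb | g'b = cong suc (countTrue-cong (λ z → rest (suc z) (λ ())))
countTrue-flip (suc b) {g} {g'} gb g'b rest rewrite rest zero (λ ()) =
  trans (cong (_ +_) (countTrue-flip b gb g'b (λ z z≢b → rest (suc z) (z≢b ∘ Fin-suc-injective))))
        (+-suc _ _)

roots : ∀ {n} → Representatives n → ℕ
roots r = countTrue (λ z → does (r z ≟ᶠ z))

module Memoisation {A : Set} (_≟_ : DecidableEquality A) {n : ℕ} (T : Fin n → A) where
  open Evaluation _≟_ T

  record Consistent (r : Representatives n) : Set where
    field
      idempotent : ∀ z → r (r z) ≡ r z
      sound : ∀ z → T z ≡ T (r z)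
  open Consistent

  identity-consistent : Consistent (λ z → z)
  identity-consistent = record { idempotent = λ _ → refl ; sound = λ _ → refl }

  same-class : ∀ {r x y} → Consistent r → r x ≡ r y → T x ≡ T y
  same-class {x = x} {y} ok rx≡ry = trans (sound ok x) (trans (cong T rx≡ry) (sym (sound ok y)))

  module _ {r : Representatives n} {a b : Fin n} (ok : Consistent r) (ra≡a : r a ≡ a) where

    identify-root : identify r a b a ≡ a
    identify-root with r a ≟ᶠ b
    ... | yes _ = refl
    ... | no _ = ra≡a

    identify-consistent : T a ≡ T b → Consistent (identify r a b)
    idempotent (identify-consistent _) z with r z ≟ᶠ b
    ... | yes _ = identify-root
    ... | no rz≢b with r (r z) ≟ᶠ b
    ...   | yes rrz≡b = ⊥-elim (rz≢b (trans (sym (idempotent ok z)) rrz≡b))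
    ...   | no _ = idempotent ok z
    sound (identify-consistent Ta≡Tb) z with r z ≟ᶠ b
    ... | yes rz≡b = trans (sound ok z) (trans (cong T rz≡b) (sym Ta≡Tb))
    ... | no _ = sound ok z

    roots-identify : r b ≡ b → a ≢ b → roots r ≡ suc (roots (identify r a b))
    roots-identify rb≡b a≢b = countTrue-flip b (dec-true (r b ≟ᶠ b) rb≡b) b-demoted unchanged
      where
      b-demoted : does (identify r a b b ≟ᶠ b) ≡ false
      b-demoted with r b ≟ᶠ b
      ... | yes _ = dec-false (a ≟ᶠ b) a≢b
      ... | no rb≢b = ⊥-elim (rb≢b rb≡b)
      unchanged : ∀ z → z ≢ b → does (r z ≟ᶠ z) ≡ does (identify r a b z ≟ᶠ z)
      unchanged z z≢b with r z ≟ᶠ b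
      ... | no _ = refl
      ... | yes rz≡b = trans (dec-false (r z ≟ᶠ z) (λ rz≡z → z≢b (trans (sym rz≡z) rz≡b)))
                             (sym (dec-false (a ≟ᶠ z) λ a≡z →
                               z≢b (trans (sym (trans (cong r (sym a≡z)) (trans ra≡a a≡z))) rz≡b)))

  -- Every query that is actually asked is either a mismatch or merges two classes.
  MemoisedRun : ∀ {X} → Representatives n → Comp n X → Set
  MemoisedRun r c = proj₂ (value (memoise r c)) ≡ value c × Consistent (proj₁ (value (memoise r c))) ×
                    queries (memoise r c) + roots (proj₁ (value (memoise r c))) ≤ roots r + mismatches c

  memoise-run : ∀ {X} (c : Comp n X) {r} → Consistent r → MemoisedRun r c
  memoise-run (ret x) {r} ok = refl , ok , ≤-reflexive (sym (+-identityʳ (roots r)))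
  memoise-run (ask x y k) {r} ok with r x ≟ᶠ r y
  ... | yes rx≡ry rewrite dec-true (T x ≟ T y) (same-class ok rx≡ry) = memoise-run (k true) ok
  ... | no rx≢ry with T x ≟ T y
  ...   | yes Tx≡Ty with memoise-run (k true) ok′
    where ok′ = identify-consistent ok (idempotent ok x)
                  (trans (sym (sound ok x)) (trans Tx≡Ty (sound ok y)))
  ...     | same , ok″ , amortised rewrite roots-identify ok (idempotent ok x) (idempotent ok y) rx≢ry =
              same , ok″ , s≤s amortised
  memoise-run (ask x y k) {r} ok | no _ | no _ with memoise-run (k false) ok
  ... | same , ok″ , amortised = same , ok″ , ≤-trans (s≤s amortised) (≤-reflexive (sym (+-suc (roots r) _)))

Edge : ℕ → Set
Edge n = Fin n × ℕ × STree n

Children : ℕ → Set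
Children n = List (Edge n)

module _ {n : ℕ} where

  -- p + k, or the junk value p when that is out of range.
  offset : Fin n → ℕ → Fin n
  offset p k with toℕ p + k <? n
  ... | yes p+k<n = fromℕ< p+k<n
  ... | no _ = p

  commonPrefix : Fin n → Fin n → ℕ → ℕ → Comp n ℕ
  commonPrefix p q k zero = ret k
  commonPrefix p q k (suc r) = ask (offset p k) (offset q k) λ where
    true → commonPrefix p q (suc k) r
    false → ret k

  subtree : Edge n → STree n
  subtree = proj₂ ∘ proj₂

  childrenOf : STree n → Children n
  childrenOf (leaf _) = []
  childrenOf (node cs) = cs

  -- The children of the point at depth l ≤ label length on an edge: the rest of the edge
  -- when l falls inside its label, the children of its subtree otherwise.
  below : ℕ → Edge n → Children n
  below l (p , l' , t) with l <? l'
  ... | yes _ = [ (offset p l , l' ∸ l , t) ]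
  ... | no _ = childrenOf t

  -- The fuel f bounds the recursion.  The correctness and cost lemmas assume that it is at least
  -- the number of edges involved, so the junk result of mergeSorted zero never arises.
  mutual
    mergeEdges : ℕ → Edge n → Edge n → Comp n (Edge n)
    mergeEdges f e@(_ , l , _) e'@(_ , l' , _) with l ≤? l'
    ... | yes _ = mergeSorted f e e'
    ... | no _ = mergeSorted f e' e

    mergeSorted : ℕ → Edge n → Edge n → Comp n (Edge n)
    mergeSorted zero e e' = ret e
    mergeSorted (suc f) e@(p , l , _) e'@(p' , _ , _) = commonPrefix p p' 0 l >>= λ h → branchAt f h e e'

    branchAt : ℕ → ℕ → Edge n → Edge n → Comp n (Edge n)
    branchAt f h (p , l , t) e'@(p' , l' , t') with h <? l
    ... | yes _ = ret (p , h , node ((offset p h , l ∸ h , t) ∷ (offset p' h , l' ∸ h , t') ∷ []))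
    ... | no _ = mergeBelow f (p , l , t) e'

    mergeBelow : ℕ → Edge n → Edge n → Comp n (Edge n)
    mergeBelow f (p , l , t) e' = mergeChildren f (childrenOf t) (below l e') >>= λ cs → ret (p , l , node cs)

    absorbPartner : ℕ → Edge n → Children n → Comp n (Edge n × Children n)
    absorbPartner f e [] = ret (e , [])
    absorbPartner f e (y ∷ ys) = ask (proj₁ e) (proj₁ y) λ where
      true → mergeEdges f e y >>= λ e' → ret (e' , ys)
      false → absorbPartner f e ys >>= λ r → ret (proj₁ r , y ∷ proj₂ r)

    mergeChildren : ℕ → Children n → Children n → Comp n (Children n)
    mergeChildren f [] xs = ret xs
    mergeChildren f (e ∷ cs) xs =
      absorbPartner f e xs >>= λ r → mergeChildren f cs (proj₂ r) >>= λ cs' → ret (proj₁ r ∷ cs')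

  mutual
    size : STree n → ℕ
    size (leaf _) = 0
    size (node cs) = sizeᶜ cs

    weight : Edge n → ℕ
    weight (_ , _ , t) = suc (size t)

    sizeᶜ : Children n → ℕ
    sizeᶜ [] = 0
    sizeᶜ (e ∷ cs) = weight e + sizeᶜ cs

  mergePairs : List (Children n) → Comp n (List (Children n))
  mergePairs [] = ret []
  mergePairs (a ∷ []) = ret (a ∷ [])
  mergePairs (a ∷ b ∷ fs) =
    mergeChildren (sizeᶜ a + sizeᶜ b) a b >>= λ c → mergePairs fs >>= λ cs → ret (c ∷ cs)

  mergeRounds : ℕ → List (Children n) → Comp n (Children n)
  mergeRounds k [] = ret []
  mergeRounds k (a ∷ []) = ret a
  mergeRounds zero (a ∷ _ ∷ _) = ret a
  mergeRounds (suc k) fs@(_ ∷ _ ∷ _) = mergePairs fs >>= mergeRounds k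

  leafEdge : Fin n → Edge n
  leafEdge i = (i , n ∸ toℕ i , leaf i)

  buildTree : List (Fin n) → Comp n (STree n)
  buildTree I = mergeRounds (length I) (map (λ i → [ leafEdge i ]) I) >>= λ cs → ret (node cs)

sparseSuffixTrees : Procedure
sparseSuffixTrees = record
  { State = Representatives
  ; init = λ _ z → z
  ; step = λ r I → memoise r (buildTree I)
  }

module _ {n : ℕ} where

  toℕ-offset : ∀ (p : Fin n) {k} → toℕ p + k < n → toℕ (offset p k) ≡ toℕ p + k
  toℕ-offset p {k} p+k<n with toℕ p + k <? n
  ... | yes lt = toℕ-fromℕ< lt
  ... | no p+k≮n = ⊥-elim (p+k≮n p+k<n)

  offset-zero : ∀ (p : Fin n) → offset p 0 ≡ p
  offset-zero p = toℕ-injective (trans (toℕ-offset p (subst (_< n) (sym (+-identityʳ _)) (toℕ<n p))) (+-identityʳ _))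

  mutual
    positions : STree n → List (Fin n)
    positions (leaf i) = [ i ]
    positions (node cs) = positionsᶜ cs

    positionsᶜ : Children n → List (Fin n)
    positionsᶜ [] = []
    positionsᶜ ((_ , _ , t) ∷ cs) = positions t ++ positionsᶜ cs

  positionsᶜ-mono : ∀ {cs xs : Children n} → cs ⊑ xs → positionsᶜ cs ⊆ positionsᶜ xs
  positionsᶜ-mono [] = λ ()
  positionsᶜ-mono {xs = (_ , _ , t) ∷ _} (_ ∷ʳ cs⊑xs) = xs⊆ys++xs _ (positions t) ∘ positionsᶜ-mono cs⊑xs
  positionsᶜ-mono {cs = (_ , _ , t) ∷ _} (refl ∷ cs⊑xs) = Subset.++⁺ʳ (positions t) (positionsᶜ-mono cs⊑xs)

  sizeᶜ-mono : ∀ {cs xs : Children n} → cs ⊑ xs → sizeᶜ cs ≤ sizeᶜ xs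
  sizeᶜ-mono [] = z≤n
  sizeᶜ-mono (y ∷ʳ cs⊑xs) = ≤-trans (sizeᶜ-mono cs⊑xs) (m≤n+m _ (weight y))
  sizeᶜ-mono (refl ∷ cs⊑xs) = +-monoʳ-≤ _ (sizeᶜ-mono cs⊑xs)

module MergeSteps {A : Set} (_≟_ : DecidableEquality A) {n : ℕ} (T : Fin n → A) where
  open Evaluation _≟_ T

  absorbPartner-rest : ∀ f e xs → proj₂ (value (absorbPartner f e xs)) ⊑ xs
  absorbPartner-rest f e [] = []
  absorbPartner-rest f e (y ∷ ys) with T (proj₁ e) ≟ T (proj₁ y)
  ... | yes _ rewrite value->>= (mergeEdges f e y) (λ e' → ret (e' , ys)) = y ∷ʳ ⊑-refl
  ... | no _ rewrite value->>= {Y = Edge n × Children n} (absorbPartner f e ys) (λ r → ret (proj₁ r , y ∷ proj₂ r)) =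
    refl ∷ absorbPartner-rest f e ys

  value-mergeChildren-∷ : ∀ f e cs xs → let r = value (absorbPartner f e xs) in
    value (mergeChildren f (e ∷ cs) xs) ≡ proj₁ r ∷ value (mergeChildren f cs (proj₂ r))
  value-mergeChildren-∷ f e cs xs = trans (value->>= (absorbPartner f e xs) _) (value->>= (mergeChildren f cs _) _)

  mismatches-mergeChildren-∷ : ∀ f e cs xs → let r = value (absorbPartner f e xs) in
    mismatches (mergeChildren f (e ∷ cs) xs) ≡ mismatches (absorbPartner f e xs) + (mismatches (mergeChildren f cs (proj₂ r)) + 0)
  mismatches-mergeChildren-∷ f e cs xs =
    trans (mismatches->>= (absorbPartner f e xs) _) (cong (_ +_) (mismatches->>= (mergeChildren f cs _) _))

  value-mergePairs : ∀ a b fs →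
    value (mergePairs (a ∷ b ∷ fs)) ≡ value (mergeChildren (sizeᶜ a + sizeᶜ b) a b) ∷ value (mergePairs fs)
  value-mergePairs a b fs = trans (value->>= (mergeChildren (sizeᶜ a + sizeᶜ b) a b) _) (value->>= (mergePairs fs) _)

  mismatches-mergePairs : ∀ a b fs →
    mismatches (mergePairs (a ∷ b ∷ fs)) ≡ mismatches (mergeChildren (sizeᶜ a + sizeᶜ b) a b) + (mismatches (mergePairs fs) + 0)
  mismatches-mergePairs a b fs =
    trans (mismatches->>= (mergeChildren (sizeᶜ a + sizeᶜ b) a b) _) (cong (_ +_) (mismatches->>= (mergePairs fs) _))

module Text {A : Set} (m : ℕ) (T : Fin (suc m) → A) (sentinel : Sentinel T) where

  n : ℕ
  n = suc m

  L : List A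
  L = toList T

  seg : ℕ → ℕ → List A
  seg a k = take k (drop a L)

  length-drop-L : ∀ a → length (drop a L) ≡ n ∸ a
  length-drop-L a = trans (length-drop a L) (cong (_∸ a) (length-tabulate T))

  length-seg : ∀ {a k} → a + k ≤ n → length (seg a k) ≡ k
  length-seg {a} {k} a+k≤n = trans (length-take k (drop a L))
    (m≤n⇒m⊓n≡m (subst (k ≤_) (sym (length-drop-L a)) (subst (_≤ n ∸ a) (m+n∸m≡n a k) (∸-monoˡ-≤ a a+k≤n))))

  seg-split : ∀ a {h l} → h ≤ l → seg a l ≡ seg a h ++ seg (a + h) (l ∸ h)
  seg-split a {h} {l} h≤l = trans (take-++-drop h l (drop a L) h≤l) (cong (λ xs → seg a h ++ take (l ∸ h) xs) (drop-drop a h L))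

  drop-at : ∀ {a} (a<n : a < n) → drop a L ≡ T (fromℕ< a<n) ∷ drop (suc a) L
  drop-at a<n = subst (λ b → drop b L ≡ T (fromℕ< a<n) ∷ drop (suc b) L) (toℕ-fromℕ< a<n) (drop-tabulate T (fromℕ< a<n))

  seg-nonempty : ∀ {a k} → a < n → 0 < k → seg a k ≢ []
  seg-nonempty {k = suc k} a<n _ rewrite drop-at a<n = λ ()

  seg-offset : ∀ (p : Fin n) {h l} → h < l → toℕ p + l ≤ n →
               seg (toℕ p) h ++ seg (toℕ (offset p h)) (l ∸ h) ≡ seg (toℕ p) l
  seg-offset p {h} {l} h<l p+l≤n rewrite toℕ-offset p (<-≤-trans (+-monoʳ-< (toℕ p) h<l) p+l≤n) =
    sym (seg-split (toℕ p) (<⇒≤ h<l))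

  seg-snoc : ∀ (p : Fin n) {k} → toℕ p + k < n → seg (toℕ p) (suc k) ≡ seg (toℕ p) k ++ [ T (offset p k) ]
  seg-snoc p {k} p+k<n = trans (seg-split (toℕ p) (n≤1+n k))
    (cong (seg (toℕ p) k ++_) (begin
      take (suc k ∸ k) (drop (toℕ p + k) L) ≡⟨ cong₂ take (m+n∸n≡m 1 k) (cong (λ b → drop b L) (sym (toℕ-offset p p+k<n))) ⟩
      take 1 (drop (toℕ (offset p k)) L)   ≡⟨ cong (take 1) (drop-tabulate T (offset p k)) ⟩
      [ T (offset p k) ]                   ∎))
    where open ≡-Reasoning

  drop-n : drop n L ≡ []
  drop-n = drop-all n L (≤-reflexive (length-tabulate T))

  drop-m : drop m L ≡ [ T (fromℕ m) ]
  drop-m = begin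
    drop m L                                   ≡⟨ cong (λ b → drop b L) (toℕ-fromℕ m) ⟨
    drop (toℕ (fromℕ m)) L                     ≡⟨ drop-tabulate T (fromℕ m) ⟩
    T (fromℕ m) ∷ drop (suc (toℕ (fromℕ m))) L ≡⟨ cong (λ b → T (fromℕ m) ∷ drop (suc b) L) (toℕ-fromℕ m) ⟩
    T (fromℕ m) ∷ drop n L                     ≡⟨ cong (T (fromℕ m) ∷_) drop-n ⟩
    [ T (fromℕ m) ]                            ∎
    where open ≡-Reasoning

  drop-ends-with-sentinel : ∀ {a} → a < n → ∃ λ u → drop a L ≡ u ++ [ T (fromℕ m) ]
  drop-ends-with-sentinel {a} a<n = seg a (m ∸ a) , (begin
    drop a L                                 ≡⟨ take++drop≡id (m ∸ a) (drop a L) ⟨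
    seg a (m ∸ a) ++ drop (m ∸ a) (drop a L) ≡⟨ cong (seg a (m ∸ a) ++_) (drop-drop a (m ∸ a) L) ⟩
    seg a (m ∸ a) ++ drop (a + (m ∸ a)) L    ≡⟨ cong (λ b → seg a (m ∸ a) ++ drop b L) (m+[n∸m]≡n (≤-pred a<n)) ⟩
    seg a (m ∸ a) ++ drop m L                ≡⟨ cong (seg a (m ∸ a) ++_) drop-m ⟩
    seg a (m ∸ a) ++ [ T (fromℕ m) ]         ∎)
    where open ≡-Reasoning

  drop-nonempty : ∀ {a} → drop a L ≢ [] → a < n
  drop-nonempty {a} nonempty with a <? n
  ... | yes a<n = a<n
  ... | no a≮n = ⊥-elim (nonempty (drop-all a L (subst (_≤ a) (sym (length-tabulate T)) (≮⇒≥ a≮n))))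

  drop-sentinel : ∀ k {x w} → drop k L ≡ x ∷ w → x ≡ T (fromℕ m) → w ≡ []
  drop-sentinel k {x} {w} eq x≡last = begin
    w               ≡⟨ ∷-injectiveʳ at-k ⟨
    drop (suc k) L  ≡⟨ cong (λ b → drop (suc b) L) k≡m ⟩
    drop n L        ≡⟨ drop-n ⟩
    []              ∎
    where
    open ≡-Reasoning
    k<n : k < n
    k<n = drop-nonempty (λ d≡[] → case trans (sym eq) d≡[] of λ ())
    at-k : T (fromℕ< k<n) ∷ drop (suc k) L ≡ x ∷ w
    at-k = trans (sym (drop-at k<n)) eq
    k≡m : k ≡ m
    k≡m = trans (sym (toℕ-fromℕ< k<n))
            (trans (cong toℕ (sentinel (fromℕ< k<n) (trans (∷-injectiveˡ at-k) x≡last))) (toℕ-fromℕ m))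

  suffix-prefix-free : ∀ {a b w} → drop a L ≢ [] → drop b L ≡ drop a L ++ w → b ≡ a
  suffix-prefix-free {a} {b} {w} nonempty eq with drop-ends-with-sentinel (drop-nonempty {a} nonempty)
  ... | u , ends = ∸-cancelˡ-≡ (<⇒≤ (drop-nonempty {b} nonemptyᵇ)) (<⇒≤ (drop-nonempty {a} nonempty))
                     (trans (sym (length-drop-L b)) (trans (cong length same) (length-drop-L a)))
    where
    w≡[] : w ≡ []
    w≡[] = drop-sentinel (b + length u) (begin
      drop (b + length u) L          ≡⟨ drop-drop b (length u) L ⟨
      drop (length u) (drop b L)     ≡⟨ cong (drop (length u)) (trans eq (trans (cong (_++ w) ends) (++-assoc u _ w))) ⟩
      drop (length u) (u ++ _ ∷ w)   ≡⟨ drop-length-++ u _ ⟩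
      _ ∷ w                          ∎) refl
      where open ≡-Reasoning
    same : drop b L ≡ drop a L
    same = trans eq (trans (cong (drop a L ++_) w≡[]) (++-identityʳ _))
    nonemptyᵇ : drop b L ≢ []
    nonemptyᵇ = nonempty ∘ trans (sym same)

module Merging {A : Set} (_≟_ : DecidableEquality A) (m : ℕ) (T : Fin (suc m) → A) (sentinel : Sentinel T) where
  open Text m T sentinel
  open Evaluation _≟_ T
  open MergeSteps _≟_ T

  Leaf : Set
  Leaf = List A × Fin n

  prefixed : List A → List Leaf → List Leaf
  prefixed u = map (map₁ (u ++_))

  leavesE : Edge n → List Leaf
  leavesE (p , l , t) = prefixed (seg (toℕ p) l) (leaves T t)

  prefixed-++ : ∀ u v P → prefixed u (prefixed v P) ≡ prefixed (u ++ v) P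
  prefixed-++ u v P = trans (sym (map-∘ P)) (map-cong (λ (s , i) → cong (_, i) (sym (++-assoc u v s))) P)

  mutual
    positions-leaves : ∀ t → map proj₂ (leaves T t) ≡ positions t
    positions-leaves (leaf i) = refl
    positions-leaves (node cs) = positionsᶜ-leaves cs

    positionsᶜ-leaves : ∀ cs → map proj₂ (leavesL T cs) ≡ positionsᶜ cs
    positionsᶜ-leaves [] = refl
    positionsᶜ-leaves ((p , l , t) ∷ cs) = trans (map-++ proj₂ (leavesE (p , l , t)) (leavesL T cs))
      (cong₂ _++_ (trans (sym (map-∘ (leaves T t))) (positions-leaves t)) (positionsᶜ-leaves cs))

  LeafAt : ℕ → Leaf → Set
  LeafAt d (s , i) = s ≡ drop (toℕ i + d) L

  LeafAt-prefixed : ∀ {d} u P → All (LeafAt d) (prefixed u P) → All (LeafAt (d + length u)) P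
  LeafAt-prefixed {d} u P at = All.map (λ {q} → step q) (All.map⁻ at)
    where
    step : ∀ q → LeafAt d (map₁ (u ++_) q) → LeafAt (d + length u) q
    step (s , i) u++s≡ = begin
      s                                     ≡⟨ drop-length-++ u s ⟨
      drop (length u) (u ++ s)              ≡⟨ cong (drop (length u)) u++s≡ ⟩
      drop (length u) (drop (toℕ i + d) L)  ≡⟨ drop-drop (toℕ i + d) (length u) L ⟩
      drop (toℕ i + d + length u) L         ≡⟨ cong (λ k → drop k L) (+-assoc (toℕ i) d (length u)) ⟩
      drop (toℕ i + (d + length u)) L       ∎
      where open ≡-Reasoning

  -- An edge hanging from a node at string depth d in a compacted trie of suffixes of T.
  record GoodEdge (d : ℕ) (e : Edge n) : Set where
    constructor goodEdge
    field
      labelOK : EdgeOK T (proj₁ e) (proj₁ (proj₂ e))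
      subtreeOK : NonRootOK T (proj₂ (proj₂ e))
      leavesAt : All (LeafAt d) (leavesE e)

  record GoodChildren (d : ℕ) (cs : Children n) : Set where
    constructor goodChildren
    field
      childrenOK : ChildrenOK T cs
      distinct : DistinctFirst T cs
      leavesAtᶜ : All (LeafAt d) (leavesL T cs)

  Avoid : A → Children n → Set
  Avoid c = All (λ e → c ≢ T (proj₁ e))

  good-∷ : ∀ {d e cs} → GoodEdge d e → Avoid (T (proj₁ e)) cs → GoodChildren d cs → GoodChildren d (e ∷ cs)
  good-∷ (goodEdge lok sok la) av (goodChildren ch df la′) = goodChildren ((lok , sok) ∷ ch) (av ∷ df) (All.++⁺ la la′)

  good-head : ∀ {d e cs} → GoodChildren d (e ∷ cs) → GoodEdge d e
  good-head {e = e} (goodChildren ((lok , sok) ∷ _) _ la) = goodEdge lok sok (All.++⁻ˡ (leavesE e) la)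

  good-tail : ∀ {d e cs} → GoodChildren d (e ∷ cs) → GoodChildren d cs
  good-tail {e = e} (goodChildren (_ ∷ ch) (_ ∷ df) la) = goodChildren ch df (All.++⁻ʳ (leavesE e) la)

  head-avoids : ∀ {d e cs} → GoodChildren d (e ∷ cs) → Avoid (T (proj₁ e)) cs
  head-avoids (goodChildren _ (av ∷ _) _) = av

  record MergedEdge (d : ℕ) (e e' r : Edge n) : Set where
    constructor mergedEdge
    field
      good : GoodEdge d r
      sameFirst : T (proj₁ r) ≡ T (proj₁ e)
      leaves↭ : leavesE r ↭ leavesE e ++ leavesE e'

  record Absorbed (d : ℕ) (e : Edge n) (xs : Children n) (r : Edge n × Children n) : Set where
    constructor absorbed
    field
      good : GoodEdge d (proj₁ r)
      sameFirst : T (proj₁ (proj₁ r)) ≡ T (proj₁ e)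
      rest : GoodChildren d (proj₂ r)
      restAvoids : Avoid (T (proj₁ e)) (proj₂ r)
      leaves↭ : leavesE (proj₁ r) ++ leavesL T (proj₂ r) ↭ leavesE e ++ leavesL T xs

  record MergedChildren (d : ℕ) (cs xs r : Children n) : Set where
    constructor mergedChildren
    field
      good : GoodChildren d r
      leaves↭ : leavesL T r ↭ leavesL T cs ++ leavesL T xs
      avoids : ∀ {c} → Avoid c cs → Avoid c xs → Avoid c r
      wider : length cs ≤ length r

  seg-extend : ∀ (p q : Fin n) {k} → seg (toℕ p) k ≡ seg (toℕ q) k → toℕ p + k < n → toℕ q + k < n →
               T (offset p k) ≡ T (offset q k) → seg (toℕ p) (suc k) ≡ seg (toℕ q) (suc k)
  seg-extend p q same p+k<n q+k<n match =
    trans (seg-snoc p p+k<n) (trans (cong₂ (λ u c → u ++ [ c ]) same match) (sym (seg-snoc q q+k<n)))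

  commonPrefix-correct : ∀ p q k r → seg (toℕ p) k ≡ seg (toℕ q) k → toℕ p + (k + r) ≤ n → toℕ q + (k + r) ≤ n →
    let h = value (commonPrefix p q k r) in
    h ≤ k + r × seg (toℕ p) h ≡ seg (toℕ q) h × (h < k + r → T (offset p h) ≢ T (offset q h))
  commonPrefix-correct p q k zero same _ _ =
    ≤-reflexive (sym (+-identityʳ k)) , same , λ k<k+0 → ⊥-elim (<-irrefl (sym (+-identityʳ k)) k<k+0)
  commonPrefix-correct p q k (suc r) same p≤ q≤ with T (offset p k) ≟ T (offset q k)
  ... | no mismatch = m≤m+n k (suc r) , same , λ _ → mismatch
  ... | yes match with commonPrefix-correct p q (suc k) r
                         (seg-extend p q same (room p≤) (room q≤) match) (shift p≤) (shift q≤)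
    where
    room : ∀ {a} → a + (k + suc r) ≤ n → a + k < n
    room {a} = <-≤-trans (+-monoʳ-< a (m<m+n k z<s))
    shift : ∀ {a} → a + (k + suc r) ≤ n → a + (suc k + r) ≤ n
    shift {a} = subst (λ j → a + j ≤ n) (+-suc k r)
  ...   | h≤ , same′ , mismatch = subst (h ≤_) (sym (+-suc k r)) h≤ , same′ , mismatch ∘ subst (h <_) (+-suc k r)
    where h = value (commonPrefix p q (suc k) r)

  leaves-nonempty : ∀ {t} → NonRootOK T t → ∃ λ q → q ∈ leaves T t
  leaves-nonempty (leafOK i) = _ , here refl
  leaves-nonempty (nodeOK {(p , l , t) ∷ _} _ _ ((_ , sok) ∷ _)) with leaves-nonempty sok
  ... | q , q∈ = _ , ∈-++⁺ˡ (∈-map⁺ _ q∈)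

  -- A leaf edge cannot be a prefix of another edge: the suffix at that leaf would be a prefix of
  -- a suffix at some leaf below the other edge, so both leaves carry the same position.
  leaf-not-prefix : ∀ {d p l i p' l' t'} → GoodEdge d (p , l , leaf i) → GoodEdge d (p' , l' , t') → l ≤ l' →
                    seg (toℕ p) l ≡ seg (toℕ p') l → ¬ Disjoint [ i ] (positions t')
  leaf-not-prefix {d} {p} {l} {i} {p'} {l'} {t'} (goodEdge (0<l , _) _ (at-i ∷ [])) (goodEdge _ sok' at') l≤l' same disjoint
    with leaves-nonempty sok'
  ... | (s , j) , sj∈ = disjoint (here refl , subst (_∈ positions t') (sym i≡j) j∈)
    where
    j∈ : j ∈ positions t'
    j∈ = subst (j ∈_) (positions-leaves t') (∈-map⁺ proj₂ sj∈)
    at-j : seg (toℕ p') l' ++ s ≡ drop (toℕ j + d) L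
    at-j = All.lookup at' (∈-map⁺ (map₁ _) sj∈)
    seg≡ : seg (toℕ p) l ≡ drop (toℕ i + d) L
    seg≡ = trans (sym (++-identityʳ _)) at-i
    extends : drop (toℕ j + d) L ≡ drop (toℕ i + d) L ++ (seg (toℕ p' + l) (l' ∸ l) ++ s)
    extends = begin
      drop (toℕ j + d) L                                          ≡⟨ at-j ⟨
      seg (toℕ p') l' ++ s                                        ≡⟨ cong (_++ s) (seg-split (toℕ p') l≤l') ⟩
      (seg (toℕ p') l ++ seg (toℕ p' + l) (l' ∸ l)) ++ s          ≡⟨ ++-assoc (seg (toℕ p') l) _ s ⟩
      seg (toℕ p') l ++ seg (toℕ p' + l) (l' ∸ l) ++ s            ≡⟨ cong (_++ _) (trans (sym same) seg≡) ⟩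
      drop (toℕ i + d) L ++ seg (toℕ p' + l) (l' ∸ l) ++ s        ∎
      where open ≡-Reasoning
    i≡j : i ≡ j
    i≡j = toℕ-injective (+-cancelʳ-≡ d _ _ (sym (suffix-prefix-free
            (λ d≡[] → seg-nonempty (toℕ<n p) 0<l (trans seg≡ d≡[])) extends)))

  offset-edgeOK : ∀ (p : Fin n) {h l} → h < l → toℕ p + l ≤ n → EdgeOK T (offset p h) (l ∸ h)
  offset-edgeOK p {h} {l} h<l p+l≤n = m<n⇒0<n∸m h<l , ≤-trans (≤-reflexive (begin
      toℕ (offset p h) + (l ∸ h) ≡⟨ cong (_+ (l ∸ h)) (toℕ-offset p (<-≤-trans (+-monoʳ-< (toℕ p) h<l) p+l≤n)) ⟩
      toℕ p + h + (l ∸ h)        ≡⟨ +-assoc (toℕ p) h (l ∸ h) ⟩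
      toℕ p + (h + (l ∸ h))      ≡⟨ cong (toℕ p +_) (m+[n∸m]≡n (<⇒≤ h<l)) ⟩
      toℕ p + l                  ∎)) p+l≤n
    where open ≡-Reasoning

  leaves-offset : ∀ (p : Fin n) {h l} t → h < l → toℕ p + l ≤ n →
                  prefixed (seg (toℕ p) h) (leavesE (offset p h , l ∸ h , t)) ≡ leavesE (p , l , t)
  leaves-offset p t h<l p+l≤n =
    trans (prefixed-++ _ _ (leaves T t)) (cong (λ u → prefixed u (leaves T t)) (seg-offset p h<l p+l≤n))

  split-correct : ∀ {d p l t p' l' t' h} → 0 < h → h < l → l ≤ l' → seg (toℕ p) h ≡ seg (toℕ p') h →
    T (offset p h) ≢ T (offset p' h) → GoodEdge d (p , l , t) → GoodEdge d (p' , l' , t') →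
    MergedEdge d (p , l , t) (p' , l' , t')
      (p , h , node ((offset p h , l ∸ h , t) ∷ (offset p' h , l' ∸ h , t') ∷ []))
  split-correct {d} {p} {l} {t} {p'} {l'} {t'} {h} 0<h h<l l≤l' same mismatch
    (goodEdge (_ , p+l≤n) sok at) (goodEdge (_ , p'+l'≤n) sok' at') =
    mergedEdge (goodEdge (0<h , ≤-trans (+-monoʳ-≤ (toℕ p) (<⇒≤ h<l)) p+l≤n)
                         (nodeOK (s≤s (s≤s z≤n)) ((mismatch ∷ []) ∷ [] ∷ [])
                                 ((offset-edgeOK p h<l p+l≤n , sok) ∷ (offset-edgeOK p' h<l' p'+l'≤n , sok') ∷ []))
                         (subst (All (LeafAt d)) (sym split-leaves) (All.++⁺ at at')))
               refl (↭-reflexive split-leaves)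
    where
    h<l' = <-≤-trans h<l l≤l'
    x = (offset p h , l ∸ h , t)
    x' = (offset p' h , l' ∸ h , t')
    split-leaves : leavesE (p , h , node (x ∷ x' ∷ [])) ≡ leavesE (p , l , t) ++ leavesE (p' , l' , t')
    split-leaves = trans (map-++ _ (leavesE x) (leavesE x' ++ []))
      (cong₂ _++_ (leaves-offset p t h<l p+l≤n)
                  (trans (cong₂ prefixed same (++-identityʳ _)) (leaves-offset p' t' h<l' p'+l'≤n)))

  descend : ∀ {d u l} xs e' → prefixed u (leavesL T xs) ≡ leavesE e' → length u ≡ l →
            All (LeafAt d) (leavesE e') → All (LeafAt (d + l)) (leavesL T xs)
  descend {d} {u} xs e' xs-leaves refl at = LeafAt-prefixed u (leavesL T xs) (subst (All (LeafAt d)) (sym xs-leaves) at)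

  merged-node : ∀ {d p l cs e' xs r} → GoodEdge d (p , l , node cs) → All (LeafAt d) (leavesE e') →
    prefixed (seg (toℕ p) l) (leavesL T xs) ≡ leavesE e' →
    MergedChildren (d + l) cs xs r → MergedEdge d (p , l , node cs) e' (p , l , node r)
  merged-node {d} {p} {l} {cs} {e'} {xs} {r} (goodEdge lok (nodeOK two _ _) at) at' xs-leaves
    (mergedChildren (goodChildren ch df _) perm _ wider) =
    mergedEdge (goodEdge lok (nodeOK (≤-trans two wider) df ch) (All-resp-↭ (↭-sym leaves↭) (All.++⁺ at at')))
               refl leaves↭
    where
    open PermutationReasoning
    u = seg (toℕ p) l
    leaves↭ : prefixed u (leavesL T r) ↭ leavesE (p , l , node cs) ++ leavesE e'
    leaves↭ = begin
      prefixed u (leavesL T r)                              ↭⟨ ↭-map⁺ _ perm ⟩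
      prefixed u (leavesL T cs ++ leavesL T xs)             ≡⟨ map-++ _ (leavesL T cs) (leavesL T xs) ⟩
      prefixed u (leavesL T cs) ++ prefixed u (leavesL T xs) ≡⟨ cong (prefixed u (leavesL T cs) ++_) xs-leaves ⟩
      leavesE (p , l , node cs) ++ leavesE e'               ∎

  children-good : ∀ {d p l cs} → GoodEdge d (p , l , node cs) → GoodChildren (d + l) cs
  children-good {p = p} {l} {cs} (goodEdge (_ , p+l≤n) (nodeOK _ df ch) at) =
    goodChildren ch df (descend cs (p , l , node cs) refl (length-seg p+l≤n) at)

  mismatch-positive : ∀ {p p' : Fin n} {h l} → T p ≡ T p' → (h < l → T (offset p h) ≢ T (offset p' h)) → h < l → 0 < h
  mismatch-positive {p} {p'} {zero} first mismatch h<l =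
    ⊥-elim (mismatch h<l (subst₂ (λ a b → T a ≡ T b) (sym (offset-zero p)) (sym (offset-zero p')) first))
  mismatch-positive {h = suc _} _ _ _ = z<s

  swap-merged : ∀ {d e e' r} → T (proj₁ e) ≡ T (proj₁ e') → MergedEdge d e' e r → MergedEdge d e e' r
  swap-merged {e = e} {e'} first (mergedEdge good sameFirst perm) =
    mergedEdge good (trans sameFirst (sym first)) (↭-trans perm (↭-++-comm (leavesE e') (leavesE e)))

  mutual
    mergeEdges-correct : ∀ f {d p l t p' l' t'} → GoodEdge d (p , l , t) → GoodEdge d (p' , l' , t') → T p ≡ T p' →
      Disjoint (positions t) (positions t') → suc (size t) + suc (size t') ≤ f →
      MergedEdge d (p , l , t) (p' , l' , t') (value (mergeEdges f (p , l , t) (p' , l' , t')))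
    mergeEdges-correct f {l = l} {t} {l' = l'} {t'} g g' first disjoint fuel with l ≤? l'
    ... | yes l≤l' = mergeSorted-correct f l≤l' g g' first disjoint fuel
    ... | no l≰l' = swap-merged first (mergeSorted-correct f (<⇒≤ (≰⇒> l≰l')) g' g (sym first)
                      (Disjoint.sym disjoint) (subst (_≤ f) (+-comm (suc (size t)) _) fuel))

    mergeSorted-correct : ∀ f {d p l t p' l' t'} → l ≤ l' → GoodEdge d (p , l , t) → GoodEdge d (p' , l' , t') →
      T p ≡ T p' → Disjoint (positions t) (positions t') → suc (size t) + suc (size t') ≤ f →
      MergedEdge d (p , l , t) (p' , l' , t') (value (mergeSorted f (p , l , t) (p' , l' , t')))
    mergeSorted-correct (suc f) {p = p} {l} {t} {p'} {l'} {t'} l≤l' g@(goodEdge (_ , p+l≤n) _ _)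
      g'@(goodEdge (_ , p'+l'≤n) _ _) first disjoint (s≤s fuel)
      rewrite value->>= (commonPrefix p p' 0 l) (λ h → branchAt f h (p , l , t) (p' , l' , t'))
      with commonPrefix-correct p p' 0 l refl p+l≤n (≤-trans (+-monoʳ-≤ (toℕ p') l≤l') p'+l'≤n)
    ... | h≤l , same , mismatch = branchAt-correct f l≤l' h≤l same mismatch g g' first disjoint fuel

    branchAt-correct : ∀ f {d h p l t p' l' t'} → l ≤ l' → h ≤ l → seg (toℕ p) h ≡ seg (toℕ p') h →
      (h < l → T (offset p h) ≢ T (offset p' h)) → GoodEdge d (p , l , t) → GoodEdge d (p' , l' , t') → T p ≡ T p' →
      Disjoint (positions t) (positions t') → size t + suc (size t') ≤ f →
      MergedEdge d (p , l , t) (p' , l' , t') (value (branchAt f h (p , l , t) (p' , l' , t')))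
    branchAt-correct f {h = h} {p} {l} {p' = p'} l≤l' h≤l same mismatch g g' first disjoint fuel with h <? l
    ... | yes h<l = split-correct (mismatch-positive first mismatch h<l) h<l l≤l' same (mismatch h<l) g g'
    ... | no h≮l = mergeBelow-correct f l≤l'
                     (subst (λ k → seg (toℕ p) k ≡ seg (toℕ p') k) (≤-antisym h≤l (≮⇒≥ h≮l)) same) g g' disjoint fuel

    mergeBelow-correct : ∀ f {d p l t p' l' t'} → l ≤ l' → seg (toℕ p) l ≡ seg (toℕ p') l →
      GoodEdge d (p , l , t) → GoodEdge d (p' , l' , t') → Disjoint (positions t) (positions t') →
      size t + suc (size t') ≤ f →
      MergedEdge d (p , l , t) (p' , l' , t') (value (mergeBelow f (p , l , t) (p' , l' , t')))
    mergeBelow-correct f {t = leaf i} l≤l' same g g' disjoint fuel = ⊥-elim (leaf-not-prefix g g' l≤l' same disjoint)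
    mergeBelow-correct f {d} {p} {l} {node cs} {p'} {l'} {t'} l≤l' same
      g@(goodEdge (_ , p+l≤n) _ _) g'@(goodEdge (_ , p'+l'≤n) sok' at') disjoint fuel
      rewrite value->>= (mergeChildren f cs (below l (p' , l' , t'))) (λ cs′ → ret (p , l , node cs′))
      with l <? l'
    ... | yes l<l' = merged-node g at' x-leaves
          (mergeChildren-correct f (children-good g) x-good
            (disjoint-⊆ id (Subset.⊆-reflexive (++-identityʳ _)) disjoint)
            (subst (λ k → sizeᶜ cs + k ≤ f) (sym (+-identityʳ _)) fuel))
      where
      x = (offset p' l , l' ∸ l , t')
      x-leaves : prefixed (seg (toℕ p) l) (leavesL T (x ∷ [])) ≡ leavesE (p' , l' , t')
      x-leaves = trans (cong₂ prefixed same (++-identityʳ _)) (leaves-offset p' t' l<l' p'+l'≤n)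
      x-good : GoodChildren (d + l) (x ∷ [])
      x-good = goodChildren ((offset-edgeOK p' l<l' p'+l'≤n , sok') ∷ []) ([] ∷ [])
                 (descend (x ∷ []) (p' , l' , t') x-leaves (length-seg p+l≤n) at')
    ... | no l≮l' with ≤-antisym l≤l' (≮⇒≥ l≮l')
    ...   | refl = mergeLevel-correct f same g g' disjoint fuel

    mergeLevel-correct : ∀ f {d p l cs p' t'} → seg (toℕ p) l ≡ seg (toℕ p') l →
      GoodEdge d (p , l , node cs) → GoodEdge d (p' , l , t') → Disjoint (positionsᶜ cs) (positions t') →
      sizeᶜ cs + suc (size t') ≤ f →
      MergedEdge d (p , l , node cs) (p' , l , t') (p , l , node (value (mergeChildren f cs (childrenOf t'))))
    mergeLevel-correct f {t' = leaf j} same g g' disjoint fuel =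
      ⊥-elim (leaf-not-prefix g' g ≤-refl (sym same) (Disjoint.sym disjoint))
    mergeLevel-correct f {t' = node cs'} same g g'@(goodEdge _ _ at') disjoint fuel =
      merged-node g at' (cong (λ u → prefixed u (leavesL T cs')) same)
        (mergeChildren-correct f (children-good g) (children-good g') disjoint (≤-trans (+-monoʳ-≤ _ (n≤1+n _)) fuel))

    absorbPartner-correct : ∀ f {d} e xs → GoodEdge d e → GoodChildren d xs →
      Disjoint (positions (proj₂ (proj₂ e))) (positionsᶜ xs) → weight e + sizeᶜ xs ≤ f →
      Absorbed d e xs (value (absorbPartner f e xs))
    absorbPartner-correct f e [] g _ _ _ = absorbed g refl (goodChildren [] [] []) [] ↭-refl
    absorbPartner-correct f e (y ∷ ys) g gxs disjoint fuel with T (proj₁ e) ≟ T (proj₁ y)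
    ... | yes match rewrite value->>= (mergeEdges f e y) (λ e' → ret (e' , ys)) =
      absorbed (MergedEdge.good M) (MergedEdge.sameFirst M) (good-tail gxs)
               (All.map (λ y≢z e≡z → y≢z (trans (sym match) e≡z)) (head-avoids gxs)) perm
      where
      M = mergeEdges-correct f g (good-head gxs) match (disjoint-⊆ id (xs⊆xs++ys _ _) disjoint)
            (≤-trans (+-monoʳ-≤ (weight e) (m≤m+n (weight y) (sizeᶜ ys))) fuel)
      open PermutationReasoning
      perm : leavesE (value (mergeEdges f e y)) ++ leavesL T ys ↭ leavesE e ++ leavesE y ++ leavesL T ys
      perm = begin
        leavesE (value (mergeEdges f e y)) ++ leavesL T ys ↭⟨ ++⁺ʳ (leavesL T ys) (MergedEdge.leaves↭ M) ⟩
        (leavesE e ++ leavesE y) ++ leavesL T ys          ≡⟨ ++-assoc (leavesE e) (leavesE y) (leavesL T ys) ⟩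
        leavesE e ++ leavesE y ++ leavesL T ys            ∎
    ... | no mismatch rewrite value->>= {Y = Edge n × Children n} (absorbPartner f e ys) (λ r → ret (proj₁ r , y ∷ proj₂ r)) =
      absorbed (Absorbed.good Ab) (Absorbed.sameFirst Ab)
               (good-∷ (good-head gxs) (All-resp-⊆ (absorbPartner-rest f e ys) (head-avoids gxs)) (Absorbed.rest Ab))
               (mismatch ∷ Absorbed.restAvoids Ab) perm
      where
      Ab = absorbPartner-correct f e ys g (good-tail gxs) (disjoint-⊆ id (xs⊆ys++xs _ _) disjoint)
            (≤-trans (+-monoʳ-≤ (weight e) (m≤n+m (sizeᶜ ys) (weight y))) fuel)
      r = value (absorbPartner f e ys)
      open PermutationReasoning
      perm : leavesE (proj₁ r) ++ leavesE y ++ leavesL T (proj₂ r) ↭ leavesE e ++ leavesE y ++ leavesL T ys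
      perm = begin
        leavesE (proj₁ r) ++ leavesE y ++ leavesL T (proj₂ r) ↭⟨ shifts (leavesE (proj₁ r)) (leavesE y) ⟩
        leavesE y ++ leavesE (proj₁ r) ++ leavesL T (proj₂ r) ↭⟨ ++⁺ˡ (leavesE y) (Absorbed.leaves↭ Ab) ⟩
        leavesE y ++ leavesE e ++ leavesL T ys                ↭⟨ shifts (leavesE y) (leavesE e) ⟩
        leavesE e ++ leavesE y ++ leavesL T ys                ∎

    mergeChildren-correct : ∀ f {d cs xs} → GoodChildren d cs → GoodChildren d xs →
      Disjoint (positionsᶜ cs) (positionsᶜ xs) → sizeᶜ cs + sizeᶜ xs ≤ f →
      MergedChildren d cs xs (value (mergeChildren f cs xs))
    mergeChildren-correct f {cs = []} _ gxs _ _ = mergedChildren gxs ↭-refl (λ _ avoid → avoid) z≤n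
    mergeChildren-correct f {d} {e ∷ cs} {xs} gcs gxs disjoint fuel rewrite value-mergeChildren-∷ f e cs xs =
      mergedChildren
        (good-∷ (Absorbed.good Ab) (All.map (λ e≢ → e≢ ∘ trans (sym (Absorbed.sameFirst Ab)))
                                     (MergedChildren.avoids M (head-avoids gcs) (Absorbed.restAvoids Ab)))
                (MergedChildren.good M))
        perm
        (λ { (c≢e ∷ avoid-cs) avoid-xs → (c≢e ∘ flip trans (Absorbed.sameFirst Ab))
                                          ∷ MergedChildren.avoids M avoid-cs (All-resp-⊆ rest⊑ avoid-xs) })
        (s≤s (MergedChildren.wider M))
      where
      r = value (absorbPartner f e xs)
      rest⊑ = absorbPartner-rest f e xs
      Ab = absorbPartner-correct f e xs (good-head gcs) gxs (disjoint-⊆ (xs⊆xs++ys _ _) id disjoint)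
            (≤-trans (+-monoˡ-≤ (sizeᶜ xs) (m≤m+n (weight e) (sizeᶜ cs))) fuel)
      M = mergeChildren-correct f (good-tail gcs) (Absorbed.rest Ab)
            (disjoint-⊆ (xs⊆ys++xs _ _) (positionsᶜ-mono rest⊑) disjoint)
            (≤-trans (+-monoʳ-≤ (sizeᶜ cs) (sizeᶜ-mono rest⊑)) (≤-trans (+-monoˡ-≤ (sizeᶜ xs) (m≤n+m (sizeᶜ cs) (weight e))) fuel))
      open PermutationReasoning
      perm : leavesE (proj₁ r) ++ leavesL T (value (mergeChildren f cs (proj₂ r))) ↭ (leavesE e ++ leavesL T cs) ++ leavesL T xs
      perm = begin
        leavesE (proj₁ r) ++ leavesL T (value (mergeChildren f cs (proj₂ r)))
          ↭⟨ ++⁺ˡ (leavesE (proj₁ r)) (MergedChildren.leaves↭ M) ⟩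
        leavesE (proj₁ r) ++ leavesL T cs ++ leavesL T (proj₂ r) ↭⟨ shifts (leavesE (proj₁ r)) (leavesL T cs) ⟩
        leavesL T cs ++ leavesE (proj₁ r) ++ leavesL T (proj₂ r) ↭⟨ ++⁺ˡ (leavesL T cs) (Absorbed.leaves↭ Ab) ⟩
        leavesL T cs ++ leavesE e ++ leavesL T xs               ↭⟨ shifts (leavesL T cs) (leavesE e) ⟩
        leavesE e ++ leavesL T cs ++ leavesL T xs               ≡⟨ ++-assoc (leavesE e) (leavesL T cs) (leavesL T xs) ⟨
        (leavesE e ++ leavesL T cs) ++ leavesL T xs             ∎

module Cost {A : Set} (_≟_ : DecidableEquality A) {n : ℕ} (T : Fin n → A) (s : ℕ) (0<s : 0 < s) where
  open Evaluation _≟_ T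
  open MergeSteps _≟_ T
  open ≤-Reasoning

  data BoundedDegree : STree n → Set where
    leaf : ∀ i → BoundedDegree (leaf i)
    node : ∀ {cs} → length cs ≤ s → All (λ e → BoundedDegree (subtree e)) cs → BoundedDegree (node cs)

  BoundedDegreeᶜ : Children n → Set
  BoundedDegreeᶜ = All (λ e → BoundedDegree (subtree e))

  K : ℕ
  K = 2 * s

  s≤K*w : ∀ w → s ≤ K * suc w
  s≤K*w w = ≤-trans (m≤m+n s (s + 0)) (m≤m*n K (suc w))

  1+s≤K : 1 + s ≤ K
  1+s≤K = subst (λ k → 1 + k ≤ K) (+-identityʳ s) (+-monoˡ-≤ (s + 0) 0<s)

  commonPrefix-mismatches : ∀ p q k r → mismatches (commonPrefix p q k r) ≤ 1
  commonPrefix-mismatches p q k zero = z≤n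
  commonPrefix-mismatches p q k (suc r) with T (offset p k) ≟ T (offset q k)
  ... | yes _ = commonPrefix-mismatches p q (suc k) r
  ... | no _ = s≤s z≤n

  below-degree : ∀ l (e' : Edge n) → BoundedDegree (subtree e') →
                 length (below l e') ≤ s × BoundedDegreeᶜ (below l e')
  below-degree l (p , l' , t) bd with l <? l'
  ... | yes _ = 0<s , bd ∷ []
  below-degree l (p , l' , leaf i) bd | no _ = z≤n , []
  below-degree l (p , l' , node cs) (node deg bds) | no _ = deg , bds

  below-size : ∀ l (e' : Edge n) → sizeᶜ (below l e') ≤ weight e'
  below-size l (p , l' , t) with l <? l'
  ... | yes _ = ≤-reflexive (+-identityʳ _)
  below-size l (p , l' , leaf i) | no _ = z≤n
  below-size l (p , l' , node cs) | no _ = n≤1+n _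

  children-size : ∀ (t : STree n) → sizeᶜ (childrenOf t) ≡ size t
  children-size (leaf i) = refl
  children-size (node cs) = refl

  children-degree : ∀ {t} → BoundedDegree t → BoundedDegreeᶜ (childrenOf t)
  children-degree (leaf i) = []
  children-degree (node _ bds) = bds

  mutual
    -- The spare s pays for the (at most s) comparisons absorbPartner makes to find the pair.
    mergeEdges-cost : ∀ f e e' → BoundedDegree (subtree e) → BoundedDegree (subtree e') →
      mismatches (mergeEdges f e e') + s ≤ K * (weight e + weight e')
    mergeEdges-cost f e@(_ , l , _) e'@(_ , l' , _) bd bd' with l ≤? l'
    ... | yes _ = mergeSorted-cost f e e' bd bd'
    ... | no _ = subst (λ w → mismatches (mergeSorted f e' e) + s ≤ K * w) (+-comm (weight e') (weight e))
                   (mergeSorted-cost f e' e bd' bd)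

    mergeSorted-cost : ∀ f e e' → BoundedDegree (subtree e) → BoundedDegree (subtree e') →
      mismatches (mergeSorted f e e') + s ≤ K * (weight e + weight e')
    mergeSorted-cost zero (_ , _ , t) (_ , _ , t') _ _ = s≤K*w (size t + suc (size t'))
    mergeSorted-cost (suc f) (p , l , t) (p' , l' , t') bd bd'
      rewrite mismatches->>= (commonPrefix p p' 0 l) (λ h → branchAt f h (p , l , t) (p' , l' , t')) = begin
      c₁ + c₂ + s              ≤⟨ +-monoˡ-≤ s (+-mono-≤ (commonPrefix-mismatches p p' 0 l)
                                                        (branchAt-cost f h (p , l , t) (p' , l' , t') bd bd')) ⟩
      1 + K * w + s            ≡⟨ +-comm (1 + K * w) s ⟩
      s + (1 + K * w)          ≡⟨ +-suc s (K * w) ⟩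
      (1 + s) + K * w          ≤⟨ +-monoˡ-≤ (K * w) 1+s≤K ⟩
      K + K * w                ≡⟨ *-suc K w ⟨
      K * suc w                ∎
      where
      h = value (commonPrefix p p' 0 l)
      c₁ = mismatches (commonPrefix p p' 0 l)
      c₂ = mismatches (branchAt f h (p , l , t) (p' , l' , t'))
      w = size t + suc (size t')

    branchAt-cost : ∀ f h e e' → BoundedDegree (subtree e) → BoundedDegree (subtree e') →
      mismatches (branchAt f h e e') ≤ K * (size (subtree e) + weight e')
    branchAt-cost f h e@(_ , l , _) e' bd bd' with h <? l
    ... | yes _ = z≤n
    ... | no _ = mergeBelow-cost f e e' bd bd'

    mergeBelow-cost : ∀ f e e' → BoundedDegree (subtree e) → BoundedDegree (subtree e') →
      mismatches (mergeBelow f e e') ≤ K * (size (subtree e) + weight e')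
    mergeBelow-cost f (p , l , t) e' bd bd'
      rewrite mismatches->>= (mergeChildren f (childrenOf t) (below l e')) (λ cs → ret (p , l , node cs)) = begin
      mismatches (mergeChildren f (childrenOf t) xs) + 0 ≡⟨ +-identityʳ _ ⟩
      mismatches (mergeChildren f (childrenOf t) xs)     ≤⟨ mergeChildren-cost f (children-degree bd) (proj₂ deg) (proj₁ deg) ⟩
      K * (sizeᶜ (childrenOf t) + sizeᶜ xs)              ≤⟨ *-monoʳ-≤ K (+-mono-≤ (≤-reflexive (children-size t)) (below-size l e')) ⟩
      K * (size t + weight e')                           ∎
      where
      xs = below l e'
      deg = below-degree l e' bd'

    -- The scan costs at most length xs; merging with the partner y costs at most
    -- K * (weight e + weight y) - s, and the remaining children are lighter by weight y.
    absorbPartner-cost : ∀ f e xs → BoundedDegree (subtree e) → BoundedDegreeᶜ xs →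
      mismatches (absorbPartner f e xs) + K * sizeᶜ (proj₂ (value (absorbPartner f e xs))) + s
        ≤ length xs + K * (weight e + sizeᶜ xs)
    absorbPartner-cost f e [] bd _ = begin
      0 + K * 0 + s   ≡⟨ cong (_+ s) (*-zeroʳ K) ⟩
      s               ≤⟨ s≤K*w (size (subtree e) + 0) ⟩
      K * (weight e + 0) ∎
    absorbPartner-cost f e (y ∷ ys) bd (bdy ∷ bds) with T (proj₁ e) ≟ T (proj₁ y)
    ... | yes _ rewrite mismatches->>= (mergeEdges f e y) (λ e' → ret (e' , ys))
                      | value->>= (mergeEdges f e y) (λ e' → ret (e' , ys)) = begin
      c + 0 + K * sizeᶜ ys + s                     ≡⟨ rearrange c (K * sizeᶜ ys) s ⟩
      (c + s) + K * sizeᶜ ys                       ≤⟨ +-monoˡ-≤ (K * sizeᶜ ys) (mergeEdges-cost f e y bd bdy) ⟩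
      K * (weight e + weight y) + K * sizeᶜ ys     ≡⟨ distrib K (weight e) (weight y) (sizeᶜ ys) ⟩
      K * (weight e + (weight y + sizeᶜ ys))       ≤⟨ m≤n+m _ (length (y ∷ ys)) ⟩
      length (y ∷ ys) + K * (weight e + sizeᶜ (y ∷ ys)) ∎
      where
      c = mismatches (mergeEdges f e y)
      rearrange : ∀ a b c → a + 0 + b + c ≡ (a + c) + b
      rearrange = solve-∀
      distrib : ∀ k a b c → k * (a + b) + k * c ≡ k * (a + (b + c))
      distrib = solve-∀
    ... | no _ rewrite mismatches->>= {Y = Edge n × Children n} (absorbPartner f e ys) (λ r → ret (proj₁ r , y ∷ proj₂ r))
                     | value->>= {Y = Edge n × Children n} (absorbPartner f e ys) (λ r → ret (proj₁ r , y ∷ proj₂ r)) = begin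
      suc (c + 0) + K * (weight y + sizeᶜ r) + s    ≡⟨ rearrange K s c (weight y) (sizeᶜ r) ⟩
      suc (K * weight y + (c + K * sizeᶜ r + s))   ≤⟨ s≤s (+-monoʳ-≤ (K * weight y) (absorbPartner-cost f e ys bd bds)) ⟩
      suc (K * weight y + (length ys + K * (weight e + sizeᶜ ys))) ≡⟨ distrib K (length ys) (weight e) (weight y) (sizeᶜ ys) ⟩
      suc (length ys + K * (weight e + (weight y + sizeᶜ ys))) ∎
      where
      c = mismatches (absorbPartner f e ys)
      r = proj₂ (value (absorbPartner f e ys))
      rearrange : ∀ k s c a b → 1 + (c + 0) + k * (a + b) + s ≡ 1 + (k * a + (c + k * b + s))
      rearrange = solve-∀
      distrib : ∀ k x a b c → 1 + (k * b + (x + k * (a + c))) ≡ 1 + (x + k * (a + (b + c)))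
      distrib = solve-∀

    mergeChildren-cost : ∀ f {cs xs} → BoundedDegreeᶜ cs → BoundedDegreeᶜ xs → length xs ≤ s →
      mismatches (mergeChildren f cs xs) ≤ K * (sizeᶜ cs + sizeᶜ xs)
    mergeChildren-cost f {[]} _ _ _ = z≤n
    mergeChildren-cost f {e ∷ cs} {xs} (bd ∷ bds) bdxs len rewrite mismatches-mergeChildren-∷ f e cs xs = begin
      c + (c′ + 0)                               ≡⟨ cong (c +_) (+-identityʳ c′) ⟩
      c + c′                                     ≤⟨ +-monoʳ-≤ c (mergeChildren-cost f bds (All-resp-⊆ rest⊑ bdxs)
                                                      (≤-trans (length-mono-≤ rest⊑) len)) ⟩
      c + K * (sizeᶜ cs + sizeᶜ r)               ≡⟨ rearrange K c (sizeᶜ cs) (sizeᶜ r) ⟩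
      (c + K * sizeᶜ r) + K * sizeᶜ cs           ≤⟨ +-monoˡ-≤ (K * sizeᶜ cs) absorbed ⟩
      K * (weight e + sizeᶜ xs) + K * sizeᶜ cs   ≡⟨ distrib K (weight e) (sizeᶜ cs) (sizeᶜ xs) ⟩
      K * (weight e + sizeᶜ cs + sizeᶜ xs)       ∎
      where
      c = mismatches (absorbPartner f e xs)
      r = proj₂ (value (absorbPartner f e xs))
      c′ = mismatches (mergeChildren f cs r)
      rest⊑ = absorbPartner-rest f e xs
      absorbed : c + K * sizeᶜ r ≤ K * (weight e + sizeᶜ xs)
      absorbed = +-cancelʳ-≤ s _ _ (≤-trans (absorbPartner-cost f e xs bd bdxs)
                   (≤-trans (+-monoˡ-≤ _ len) (≤-reflexive (+-comm s _))))
      rearrange : ∀ k c a b → c + k * (a + b) ≡ (c + k * b) + k * a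
      rearrange = solve-∀
      distrib : ∀ k a b c → k * (a + c) + k * b ≡ k * (a + b + c)
      distrib = solve-∀

module Building {A : Set} (_≟_ : DecidableEquality A) (m : ℕ) (T : Fin (suc m) → A) (sentinel : Sentinel T) where
  open Text m T sentinel
  open Evaluation _≟_ T
  open Merging _≟_ m T sentinel
  open MergeSteps _≟_ T

  0<σ : 0 < σ _≟_ T
  0<σ = nonempty (∈-deduplicate⁺ _≟_ (∈-tabulate⁺ {f = T} zero))
    where
    nonempty : ∀ {x : A} {xs} → x ∈ xs → 0 < length xs
    nonempty (here _) = z<s
    nonempty (there _) = z<s

  open Cost _≟_ T (σ _≟_ T) 0<σ

  distinct⇒degree≤σ : ∀ {cs} → DistinctFirst T cs → length cs ≤ σ _≟_ T
  distinct⇒degree≤σ {cs} distinct = ≤-trans (≤-reflexive (sym (length-map (T ∘ proj₁) cs)))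
    (unique-⊆⇒length≤ (AllPairs.map⁺ distinct) λ x∈ → case ∈-map⁻ (T ∘ proj₁) x∈ of λ where
      (e , _ , refl) → ∈-deduplicate⁺ _≟_ (∈-tabulate⁺ {f = T} (proj₁ e)))

  mutual
    boundedDegree : ∀ {t} → NonRootOK T t → BoundedDegree t
    boundedDegree (leafOK i) = leaf i
    boundedDegree (nodeOK _ distinct children) = node (distinct⇒degree≤σ distinct) (boundedDegreeᶜ children)

    boundedDegreeᶜ : ∀ {cs} → ChildrenOK T cs → BoundedDegreeᶜ cs
    boundedDegreeᶜ [] = []
    boundedDegreeᶜ ((_ , sok) ∷ children) = boundedDegree sok ∷ boundedDegreeᶜ children

  -- Every internal node below the root branches, so a trie has fewer edges than twice its leaves.
  mutual
    weight-leaves : ∀ {t} → NonRootOK T t → suc (size t) + 1 ≤ 2 * length (leaves T t)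
    weight-leaves (leafOK i) = s≤s (s≤s z≤n)
    weight-leaves (nodeOK {cs} two _ children) = begin
      suc (sizeᶜ cs) + 1     ≡⟨ +-comm (suc (sizeᶜ cs)) 1 ⟩
      2 + sizeᶜ cs           ≡⟨ +-comm 2 (sizeᶜ cs) ⟩
      sizeᶜ cs + 2           ≤⟨ +-monoʳ-≤ (sizeᶜ cs) two ⟩
      sizeᶜ cs + length cs   ≤⟨ sizeᶜ-leaves children ⟩
      2 * length (leavesL T cs) ∎
      where open ≤-Reasoning

    sizeᶜ-leaves : ∀ {cs} → ChildrenOK T cs → sizeᶜ cs + length cs ≤ 2 * length (leavesL T cs)
    sizeᶜ-leaves [] = z≤n
    sizeᶜ-leaves {(p , l , t) ∷ cs} ((_ , sok) ∷ children) = begin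
      suc (size t) + sizeᶜ cs + suc (length cs)              ≡⟨ rearrange (suc (size t)) (sizeᶜ cs) (length cs) ⟩
      (suc (size t) + 1) + (sizeᶜ cs + length cs)            ≤⟨ +-mono-≤ (weight-leaves sok) (sizeᶜ-leaves children) ⟩
      2 * length (leaves T t) + 2 * length (leavesL T cs)    ≡⟨ cong (λ k → 2 * k + 2 * length (leavesL T cs)) (length-map _ (leaves T t)) ⟨
      2 * length (leavesE (p , l , t)) + 2 * length (leavesL T cs) ≡⟨ *-distribˡ-+ 2 (length (leavesE (p , l , t))) (length (leavesL T cs)) ⟨
      2 * (length (leavesE (p , l , t)) + length (leavesL T cs))  ≡⟨ cong (2 *_) (length-++ (leavesE (p , l , t))) ⟨
      2 * length (leavesL T ((p , l , t) ∷ cs))             ∎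
      where
      open ≤-Reasoning
      rearrange : ∀ a b c → a + b + (1 + c) ≡ (a + 1) + (b + c)
      rearrange = solve-∀

  forestLeaves : List (Children n) → List Leaf
  forestLeaves = concatMap (leavesL T)

  forestSize : List (Children n) → ℕ
  forestSize fs = sum (map sizeᶜ fs)

  DistinctPositions : List Leaf → Set
  DistinctPositions P = Unique (map proj₂ P)

  distinct-split : ∀ P Q → DistinctPositions (P ++ Q) → Disjoint (map proj₂ P) (map proj₂ Q) × DistinctPositions Q
  distinct-split P Q distinct rewrite map-++ proj₂ P Q =
    Unique-++⇒Disjoint (map proj₂ P) distinct , Unique-++⁻ʳ (map proj₂ P) distinct

  forestSize≤2*leaves : ∀ fs → All (GoodChildren 0) fs → forestSize fs ≤ 2 * length (forestLeaves fs)
  forestSize≤2*leaves [] [] = z≤n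
  forestSize≤2*leaves (a ∷ fs) (goodChildren children _ _ ∷ good) = begin
    sizeᶜ a + forestSize fs                                    ≤⟨ +-mono-≤ (≤-trans (m≤m+n _ _) (sizeᶜ-leaves children)) (forestSize≤2*leaves fs good) ⟩
    2 * length (leavesL T a) + 2 * length (forestLeaves fs)    ≡⟨ *-distribˡ-+ 2 (length (leavesL T a)) _ ⟨
    2 * (length (leavesL T a) + length (forestLeaves fs))      ≡⟨ cong (2 *_) (length-++ (leavesL T a)) ⟨
    2 * length (forestLeaves (a ∷ fs))                         ∎
    where open ≤-Reasoning

  record Paired (fs gs : List (Children n)) : Set where
    constructor paired
    field
      good : All (GoodChildren 0) gs
      leaves↭ : forestLeaves gs ↭ forestLeaves fs
      halved : length gs ≡ ⌈ length fs /2⌉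

  mergePairs-correct : ∀ fs → All (GoodChildren 0) fs → DistinctPositions (forestLeaves fs) → Paired fs (value (mergePairs fs))
  mergePairs-correct [] [] _ = paired [] ↭-refl refl
  mergePairs-correct (a ∷ []) good _ = paired good ↭-refl refl
  mergePairs-correct (a ∷ b ∷ fs) (good-a ∷ good-b ∷ good) distinct rewrite value-mergePairs a b fs =
    paired (MergedChildren.good merged ∷ Paired.good rest) leaves↭ (cong suc (Paired.halved rest))
    where
    split-a = distinct-split (leavesL T a) (leavesL T b ++ forestLeaves fs) distinct
    split-b = distinct-split (leavesL T b) (forestLeaves fs) (proj₂ split-a)
    disjoint : Disjoint (positionsᶜ a) (positionsᶜ b)
    disjoint = disjoint-⊆ (Subset.⊆-reflexive (sym (positionsᶜ-leaves a)))
                 (λ v∈ → subst (_ ∈_) (sym (map-++ proj₂ (leavesL T b) (forestLeaves fs)))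
                           (∈-++⁺ˡ (subst (_ ∈_) (sym (positionsᶜ-leaves b)) v∈)))
                 (proj₁ split-a)
    merged = mergeChildren-correct (sizeᶜ a + sizeᶜ b) good-a good-b disjoint ≤-refl
    rest = mergePairs-correct fs good (proj₂ split-b)
    open PermutationReasoning
    leaves↭ : leavesL T (value (mergeChildren (sizeᶜ a + sizeᶜ b) a b)) ++ forestLeaves (value (mergePairs fs))
              ↭ forestLeaves (a ∷ b ∷ fs)
    leaves↭ = begin
      leavesL T (value (mergeChildren (sizeᶜ a + sizeᶜ b) a b)) ++ forestLeaves (value (mergePairs fs))
        ↭⟨ ++⁺ʳ _ (MergedChildren.leaves↭ merged) ⟩
      (leavesL T a ++ leavesL T b) ++ forestLeaves (value (mergePairs fs)) ↭⟨ ++⁺ˡ (leavesL T a ++ leavesL T b) (Paired.leaves↭ rest) ⟩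
      (leavesL T a ++ leavesL T b) ++ forestLeaves fs ≡⟨ ++-assoc (leavesL T a) (leavesL T b) (forestLeaves fs) ⟩
      forestLeaves (a ∷ b ∷ fs)                       ∎

  mergeRounds-correct : ∀ k fs → length fs ≤ suc k → All (GoodChildren 0) fs → DistinctPositions (forestLeaves fs) →
    GoodChildren 0 (value (mergeRounds k fs)) × leavesL T (value (mergeRounds k fs)) ↭ forestLeaves fs
  mergeRounds-correct k [] _ _ _ = goodChildren [] [] [] , ↭-refl
  mergeRounds-correct k (a ∷ []) _ (good ∷ []) _ = good , ↭-reflexive (sym (++-identityʳ _))
  mergeRounds-correct zero (a ∷ b ∷ fs) (s≤s ()) _ _
  mergeRounds-correct (suc k) fs@(_ ∷ _ ∷ fs′) (s≤s fs≤) good distinct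
    rewrite value->>= (mergePairs fs) (mergeRounds k) with mergePairs-correct fs good distinct
  ... | paired good′ leaves↭ halved with mergeRounds-correct k (value (mergePairs fs))
        (subst (_≤ suc k) (sym halved) (≤-trans (s≤s (⌈n/2⌉≤n (length fs′))) fs≤)) good′
        (Unique-resp-↭ (↭-map⁺ proj₂ (↭-sym leaves↭)) distinct)
  ...   | good″ , leaves↭′ = good″ , ↭-trans leaves↭′ leaves↭

  mergePairs-cost : ∀ fs → All (GoodChildren 0) fs → mismatches (mergePairs fs) ≤ K * forestSize fs
  mergePairs-cost [] _ = z≤n
  mergePairs-cost (a ∷ []) _ = z≤n
  mergePairs-cost (a ∷ b ∷ fs) (goodChildren children-a _ _ ∷ goodChildren children-b distinct-b _ ∷ good)
    rewrite mismatches-mergePairs a b fs = begin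
    c + (c′ + 0)                                   ≤⟨ +-mono-≤ (mergeChildren-cost (sizeᶜ a + sizeᶜ b) (boundedDegreeᶜ children-a)
                                                        (boundedDegreeᶜ children-b) (distinct⇒degree≤σ distinct-b))
                                                      (≤-trans (≤-reflexive (+-identityʳ c′)) (mergePairs-cost fs good)) ⟩
    K * (sizeᶜ a + sizeᶜ b) + K * forestSize fs    ≡⟨ distrib K (sizeᶜ a) (sizeᶜ b) (forestSize fs) ⟩
    K * forestSize (a ∷ b ∷ fs)                    ∎
    where
    open ≤-Reasoning
    c = mismatches (mergeChildren (sizeᶜ a + sizeᶜ b) a b)
    c′ = mismatches (mergePairs fs)
    distrib : ∀ k x y z → k * (x + y) + k * z ≡ k * (x + (y + z))
    distrib = solve-∀

  -- Each round costs at most K times the number of edges, at most twice the number of leaves,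
  -- and halves the number of trees.
  mergeRounds-cost : ∀ k fs → All (GoodChildren 0) fs → DistinctPositions (forestLeaves fs) →
    mismatches (mergeRounds k fs) ≤ ⌈log₂ length fs ⌉ * (K * (2 * length (forestLeaves fs)))
  mergeRounds-cost k [] _ _ = z≤n
  mergeRounds-cost k (a ∷ []) _ _ = z≤n
  mergeRounds-cost zero (a ∷ b ∷ _) _ _ = z≤n
  mergeRounds-cost (suc k) fs@(_ ∷ _ ∷ fs′) good distinct
    rewrite mismatches->>= (mergePairs fs) (mergeRounds k) with mergePairs-correct fs good distinct
  ... | paired good′ leaves↭ halved = begin
    mismatches (mergePairs fs) + mismatches (mergeRounds k gs)
      ≤⟨ +-mono-≤ (≤-trans (mergePairs-cost fs good) (*-monoʳ-≤ K (forestSize≤2*leaves fs good)))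
                  (mergeRounds-cost k gs good′ (Unique-resp-↭ (↭-map⁺ proj₂ (↭-sym leaves↭)) distinct)) ⟩
    X + ⌈log₂ length gs ⌉ * (K * (2 * length (forestLeaves gs)))
      ≡⟨ cong (λ ℓ → X + ⌈log₂ length gs ⌉ * (K * (2 * ℓ))) (↭-length leaves↭) ⟩
    X + ⌈log₂ length gs ⌉ * X           ≡⟨ cong (λ r → X + ⌈log₂ r ⌉ * X) halved ⟩
    X + ⌈log₂ ⌈ length fs /2⌉ ⌉ * X     ≡⟨ cong (λ r → X + r * X) (⌈log₂⌈n/2⌉⌉≡⌈log₂n⌉∸1 (length fs)) ⟩
    X + (⌈log₂ length fs ⌉ ∸ 1) * X     ≡⟨ cong (_* X) (m+[n∸m]≡n (⌈log₂⌉-mono-≤ {2} {length fs} (s≤s (s≤s z≤n)))) ⟩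
    ⌈log₂ length fs ⌉ * X               ∎
    where
    open ≤-Reasoning
    gs = value (mergePairs fs)
    X = K * (2 * length (forestLeaves fs))

  singletons : List (Fin n) → List (Children n)
  singletons = map (λ i → [ leafEdge i ])

  suffix-leafEdge : ∀ i → seg (toℕ i) (n ∸ toℕ i) ++ [] ≡ suffix T i
  suffix-leafEdge i = trans (++-identityʳ _) (take-all (n ∸ toℕ i) (drop (toℕ i) L) (≤-reflexive (length-drop-L (toℕ i))))

  forestLeaves-singletons : ∀ I → forestLeaves (singletons I) ≡ map (λ i → suffix T i , i) I
  forestLeaves-singletons [] = refl
  forestLeaves-singletons (i ∷ I) = cong₂ _∷_ (cong (_, i) (suffix-leafEdge i)) (forestLeaves-singletons I)

  singletons-good : ∀ I → All (GoodChildren 0) (singletons I)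
  singletons-good [] = []
  singletons-good (i ∷ I) =
    goodChildren (((m<n⇒0<n∸m (toℕ<n i) , ≤-reflexive (m+[n∸m]≡n (<⇒≤ (toℕ<n i)))) , leafOK i) ∷ []) ([] ∷ [])
                 (trans (suffix-leafEdge i) (cong (λ k → drop k L) (sym (+-identityʳ (toℕ i)))) ∷ [])
    ∷ singletons-good I

  distinct-singletons : ∀ {I} → Unique I → DistinctPositions (forestLeaves (singletons I))
  distinct-singletons {I} unique = subst Unique (sym (begin
    map proj₂ (forestLeaves (singletons I))        ≡⟨ cong (map proj₂) (forestLeaves-singletons I) ⟩
    map proj₂ (map (λ i → suffix T i , i) I)       ≡⟨ map-∘ I ⟨
    map (λ i → i) I                                ≡⟨ map-id I ⟩
    I                                              ∎)) unique
    where open ≡-Reasoning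

  buildTree-correct : ∀ I → Unique I → IsSST T I (value (buildTree I))
  buildTree-correct I unique rewrite value->>= (mergeRounds (length I) (singletons I)) (λ cs → ret (node cs))
    with mergeRounds-correct (length I) (singletons I) (≤-trans (≤-reflexive (length-map _ I)) (n≤1+n _))
           (singletons-good I) (distinct-singletons unique)
  ... | goodChildren children distinct _ , leaves↭ = distinct , children , ↭-trans leaves↭ (↭-reflexive (forestLeaves-singletons I))

  buildTree-cost : ∀ I → Unique I → mismatches (buildTree I) ≤ 4 * (length I * σ _≟_ T * ⌈log₂ length I ⌉)
  buildTree-cost I unique rewrite mismatches->>= (mergeRounds (length I) (singletons I)) (λ cs → ret (node cs)) = begin
    mismatches (mergeRounds (length I) (singletons I)) + 0
      ≡⟨ +-identityʳ _ ⟩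
    mismatches (mergeRounds (length I) (singletons I))
      ≤⟨ mergeRounds-cost (length I) (singletons I) (singletons-good I) (distinct-singletons unique) ⟩
    ⌈log₂ length (singletons I) ⌉ * (K * (2 * length (forestLeaves (singletons I))))
      ≡⟨ cong₂ (λ a b → ⌈log₂ a ⌉ * (K * (2 * b))) (length-map _ I) (trans (cong length (forestLeaves-singletons I)) (length-map _ I)) ⟩
    ⌈log₂ length I ⌉ * (K * (2 * length I))
      ≡⟨ rearrange (length I) (σ _≟_ T) ⌈log₂ length I ⌉ ⟩
    4 * (length I * σ _≟_ T * ⌈log₂ length I ⌉) ∎
    where
    open ≤-Reasoning
    rearrange : ∀ b s g → g * (2 * s * (2 * b)) ≡ 4 * (b * s * g)
    rearrange = solve-∀

module Invocations {A : Set} (_≟_ : DecidableEquality A) (m : ℕ) (T : Fin (suc m) → A) (sentinel : Sentinel T) where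
  open Evaluation _≟_ T
  open Memoisation _≟_ T
  open Building _≟_ m T sentinel

  runSeq-correct : ∀ r → Consistent r → (Is : List (List (Fin (suc m)))) → All Unique Is →
    Pointwise (IsSST T) Is (proj₁ (runSeq sparseSuffixTrees _≟_ T r Is)) ×
    proj₂ (runSeq sparseSuffixTrees _≟_ T r Is) ≤ roots r + 4 * costSum (σ _≟_ T) Is
  runSeq-correct r ok [] [] = [] , z≤n
  runSeq-correct r ok (I ∷ Is) (unique ∷ uniques) rewrite run≡value,queries (memoise r (buildTree I))
    with memoise-run (buildTree I) ok
  ... | same , ok′ , amortised with runSeq sparseSuffixTrees _≟_ T (proj₁ (value (memoise r (buildTree I)))) Is
                                   | runSeq-correct _ ok′ Is uniques
  ...   | trees , c′ | trees-ok , rest =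
    subst (IsSST T I) (sym same) (buildTree-correct I unique) ∷ trees-ok , (begin
    c + c′                        ≤⟨ +-monoʳ-≤ c rest ⟩
    c + (roots r′ + 4 * cs)       ≡⟨ +-assoc c (roots r′) (4 * cs) ⟨
    (c + roots r′) + 4 * cs       ≤⟨ +-monoˡ-≤ (4 * cs) amortised ⟩
    (roots r + mismatches (buildTree I)) + 4 * cs
                                  ≤⟨ +-monoˡ-≤ (4 * cs) (+-monoʳ-≤ (roots r) (buildTree-cost I unique)) ⟩
    (roots r + 4 * b) + 4 * cs    ≡⟨ distrib (roots r) b cs ⟩
    roots r + 4 * (b + cs)        ∎)
    where
    open ≤-Reasoning
    c = queries (memoise r (buildTree I))
    r′ = proj₁ (value (memoise r (buildTree I)))
    cs = costSum (σ _≟_ T) Is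
    b = length I * σ _≟_ T * ⌈log₂ length I ⌉
    distrib : ∀ x y z → (x + 4 * y) + 4 * z ≡ x + 4 * (y + z)
    distrib = solve-∀

  runSeq-fresh : (Is : List (List (Fin (suc m)))) → All Unique Is →
    Pointwise (IsSST T) Is (proj₁ (runSeq sparseSuffixTrees _≟_ T (λ z → z) Is)) ×
    proj₂ (runSeq sparseSuffixTrees _≟_ T (λ z → z) Is) ≤ 4 * (suc m + costSum (σ _≟_ T) Is)
  runSeq-fresh Is uniques with runSeq-correct (λ z → z) identity-consistent Is uniques
  ... | trees , cost = trees , (begin
    proj₂ (runSeq sparseSuffixTrees _≟_ T (λ z → z) Is) ≤⟨ cost ⟩
    roots {suc m} (λ z → z) + 4 * cs                    ≤⟨ +-monoˡ-≤ (4 * cs) (countTrue≤n {suc m} (λ z → does (z ≟ᶠ z))) ⟩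
    suc m + 4 * cs                                      ≤⟨ +-monoˡ-≤ (4 * cs) (m≤n*m (suc m) 4) ⟩
    4 * suc m + 4 * cs                                  ≡⟨ *-distribˡ-+ 4 (suc m) cs ⟨
    4 * (suc m + cs)                                    ∎)
    where
    open ≤-Reasoning
    cs = costSum (σ _≟_ T) Is

lemma13 : Σ Procedure λ P → Σ ℕ λ c →
    ∀ {A : Set} (eq : DecidableEquality A) (m : ℕ) (T : Fin (suc m) → A) →
    Sentinel T → (Is : List (List (Fin (suc m)))) → All Unique Is →
    Pointwise (IsSST T) Is (proj₁ (runSeq P eq T (Procedure.init P (suc m)) Is))
    × proj₂ (runSeq P eq T (Procedure.init P (suc m)) Is) ≤ c * (suc m + costSum (σ eq T) Is)
lemma13 = sparseSuffixTrees , 4 , λ _≟_ m T sentinel → Invocations.runSeq-fresh _≟_ m T sentinel
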